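{- Let $s>0$ be an odd integer. There is a bijection between the set of order ideals of the poset $P_{s,s+2}$ that contain no two consecutive integers and the set of lattice paths of length $s$ from $(0,0)$ to $(s,y)$, where $y$ ranges over the positive integers.
   Context: $\mathbb{N}$ denotes the non-negative integers. For positive integers $s,t$, let $P_{s,t}=\mathbb{N}\setminus\{as+bt : a,b\in\mathbb{N}\}$, partially ordered as the reflexive-transitive closure of the covering relation: $x$ covers $y$ iff $x-y\in\{s,t\}$. An order ideal of a poset $P$ is a subset $I$ such that $y\in I$ and $x\le y$ imply $x\in I$. A lattice path of length $n$ is a path in $\mathbb{Z}\times\mathbb{Z}$ from $(0,0)$ to $(n,y)$ for some $y\in\mathbb{Z}$ using steps $(1,1)$ and $(1,-1)$. -}

module Defs where

open import Level using (0ℓ)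
open import Data.Nat using (ℕ; zero; suc; _+_; _*_)
open import Data.Integer as ℤ using (ℤ; +_; -[1+_])
open import Data.Bool using (Bool; T)
open import Data.Vec using (Vec; []; _∷_)
open import Data.Product using (Σ; ∃; ∃₂; _×_; proj₁)
open import Data.Sum using (_⊎_)
open import Data.Empty using (⊥)
open import Relation.Nullary using (¬_)
open import Relation.Binary.Bundles using (Setoid)
open import Relation.Binary.PropositionalEquality as Eq using (_≡_)
open import Relation.Binary.Construct.Closure.ReflexiveTransitive using (Star)

Odd : ℕ → Set
Odd s = ∃ λ k → s ≡ suc (2 * k)

InP : ℕ → ℕ → ℕ → Set
InP s t n = ¬ (∃₂ λ a b → n ≡ a * s + b * t)

Covers : ℕ → ℕ → ℕ → ℕ → Set
Covers s t x y = InP s t x × InP s t y × (x ≡ y + s ⊎ x ≡ y + t)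

_≤[_,_]_ : ℕ → ℕ → ℕ → ℕ → Set
x ≤[ s , t ] y = Star (λ a b → Covers s t b a) x y

IsOrderIdeal : ℕ → ℕ → (ℕ → Bool) → Set
IsOrderIdeal s t I =
  (∀ n → T (I n) → InP s t n) ×
  (∀ x y → x ≤[ s , t ] y → T (I y) → T (I x))

NoConsecutive : (ℕ → Bool) → Set
NoConsecutive I = ∀ n → T (I n) → T (I (suc n)) → ⊥

IdealSetoid : ℕ → Setoid 0ℓ 0ℓ
IdealSetoid s = record
  { Carrier = Σ (ℕ → Bool) (λ I → IsOrderIdeal s (s + 2) I × NoConsecutive I)
  ; _≈_ = λ I J → ∀ n → proj₁ I n ≡ proj₁ J n
  ; isEquivalence = record
    { refl = λ n → Eq.refl
    ; sym = λ p n → Eq.sym (p n)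
    ; trans = λ p q n → Eq.trans (p n) (q n)
    }
  }

-- Lattice path steps: (1,1) and (1,-1)
data Step : Set where
  up down : Step

LatticePath : ℕ → Set
LatticePath n = Vec Step n

height : ∀ {n} → LatticePath n → ℤ
height [] = + 0
height (up ∷ p) = ℤ.suc (height p)
height (down ∷ p) = ℤ.pred (height p)

PathSetoid : ℕ → Setoid 0ℓ 0ℓ
PathSetoid s = record
  { Carrier = Σ (LatticePath s) (λ p → + 0 ℤ.< height p)
  ; _≈_ = λ p q → proj₁ p ≡ proj₁ q
  ; isEquivalence = record
    { refl = Eq.refl
    ; sym = Eq.sym
    ; trans = Eq.trans
    }
  }

-- Write s = 2k + 1 and let an order ideal of P_{s,s+2} be given by its heights: for each residue r < s,
-- the number of j with r + j s in the ideal. Let x_i and y_i be the heights of the residues 2i and 2i - 1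
-- (1 ≤ i ≤ k). Closure under the covering relations says that both sequences rise by at most one per
-- step, that x_1 ≤ 1 and that y_1 ≤ x_k + 2; having no two consecutive integers says that x_i > 0 forces
-- y_i = y_(i+1) = 0. Such a column sequence consists of an initial run of positive y's, then blocks
-- (a run of positive x's, an empty column, a run of positive y's), then a final run of positive x's.
-- A run is a Łukasiewicz sequence, hence a Dyck-like path. Drawing x-runs above the axis and y-runs
-- below it turns every block into an excursion from 0 back to 0, and the final x-run followed by the
-- reversed initial y-run becomes a meander from 0 to the odd height 2 x_k + 1. The result is a path of
-- length 2k + 1 ending at a positive height, and every such path is recovered by cutting it at its last
-- return to 0 from below and at its last up-step into height ⌊h/2⌋, where h is its final height.

module Submission where

open import Level using (0ℓ)
open import Defs
open import Data.Nat
open import Data.Nat.Properties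
open import Data.Nat.DivMod
open import Data.Nat.Divisibility using (divides)
open import Data.Nat.ListAction using (sum)
open import Data.Nat.Tactic.RingSolver using (solve-∀)
open import Data.Integer as ℤ using (ℤ; -[1+_]; 0ℤ)
import Data.Integer.Properties as ℤ
open import Data.Bool using (Bool; true; false; T; if_then_else_)
open import Data.List using (List; []; _∷_; _++_; [_]; map; foldr; replicate; reverse; length)
open import Data.List.Properties
open import Data.List.Relation.Unary.All as All using (All; []; _∷_)
open import Data.Maybe using (Maybe; just; nothing; _<∣>_; fromMaybe)
import Data.Maybe as Maybe
open import Data.Product using (Σ; ∃; _×_; _,_; proj₁; proj₂; map₁)
open import Data.Sum using (_⊎_; inj₁; inj₂)
open import Data.Empty using (⊥; ⊥-elim)
open import Data.Unit using (⊤; tt)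
open import Data.Vec as Vec using (Vec; toList)
open import Data.Vec.Properties using (toList-cast; toList∘fromList; toList-injective; length-toList)
open import Data.Vec.Relation.Binary.Equality.Cast using (cast-is-id)
open import Relation.Nullary using (¬_; yes; no)
open import Relation.Binary.Bundles using (Setoid)
open import Relation.Binary.PropositionalEquality hiding ([_])
import Relation.Binary.Construct.On as On
open import Relation.Binary.Construct.Closure.ReflexiveTransitive using (ε; _◅_)
open import Function using (_∘′_)
open import Function.Bundles using (Inverse; Bijection)
open import Function.Definitions using (Congruent; StrictlyInverseˡ; StrictlyInverseʳ)
import Function.Consequences.Setoid as Consequences
open import Function.Construct.Composition using (inverse)
open import Function.Properties.Inverse using (Inverse⇒Bijection)


-- Paths, meanders and Łukasiewicz sequences

opposite : Step → Step
opposite up = down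
opposite down = up

mirror : List Step → List Step
mirror = map opposite

backwards : List Step → List Step
backwards xs = mirror (reverse xs)

opposite-involutive : ∀ x → opposite (opposite x) ≡ x
opposite-involutive up = refl
opposite-involutive down = refl

mirror-involutive : ∀ xs → mirror (mirror xs) ≡ xs
mirror-involutive xs = trans (sym (map-∘ xs)) (trans (map-cong opposite-involutive xs) (map-id xs))

backwards-involutive : ∀ xs → backwards (backwards xs) ≡ xs
backwards-involutive xs = begin
  mirror (reverse (mirror (reverse xs)))  ≡⟨ cong mirror (reverse-map opposite (reverse xs)) ⟨
  mirror (mirror (reverse (reverse xs)))  ≡⟨ mirror-involutive _ ⟩
  reverse (reverse xs)                    ≡⟨ reverse-involutive xs ⟩
  xs                                      ∎
  where open ≡-Reasoning

length-mirror : ∀ xs → length (mirror xs) ≡ length xs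
length-mirror = length-map opposite

length-backwards : ∀ xs → length (backwards xs) ≡ length xs
length-backwards xs = trans (length-mirror (reverse xs)) (length-reverse xs)

data Meander : ℕ → List Step → ℕ → Set where
  end    : ∀ {c} → Meander c [] c
  up∷_   : ∀ {c xs e} → Meander (suc c) xs e → Meander c (up ∷ xs) e
  down∷_ : ∀ {c xs e} → Meander c xs e → Meander (suc c) (down ∷ xs) e

meander-++ : ∀ {a b c xs ys} → Meander a xs b → Meander b ys c → Meander a (xs ++ ys) c
meander-++ end q = q
meander-++ (up∷ p) q = up∷ meander-++ p q
meander-++ (down∷ p) q = down∷ meander-++ p q

meander-split : ∀ {a c} xs {ys} → Meander a (xs ++ ys) c → ∃ λ b → Meander a xs b × Meander b ys c
meander-split [] p = _ , end , p
meander-split (up ∷ xs) (up∷ p) with meander-split xs p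
... | b , q , r = b , up∷ q , r
meander-split (down ∷ xs) (down∷ p) with meander-split xs p
... | b , q , r = b , down∷ q , r

meander-downs : ∀ n c → Meander (n + c) (replicate n down) c
meander-downs zero c = end
meander-downs (suc n) c = down∷ meander-downs n c

meander-lift : ∀ {a xs b} n → Meander a xs b → Meander (a + n) xs (b + n)
meander-lift n end = end
meander-lift n (up∷ p) = up∷ meander-lift n p
meander-lift n (down∷ p) = down∷ meander-lift n p

meander-backwards : ∀ {a xs b} → Meander a xs b → Meander b (backwards xs) a
meander-backwards end = end
meander-backwards (up∷_ {xs = xs} p)
  rewrite unfold-reverse up xs | map-++ opposite (reverse xs) [ up ] =
  meander-++ (meander-backwards p) (down∷ end)
meander-backwards (down∷_ {xs = xs} p)
  rewrite unfold-reverse down xs | map-++ opposite (reverse xs) [ down ] =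
  meander-++ (meander-backwards p) (up∷ end)

meander-parity : ∀ {c xs e} → Meander c xs e → ∃ λ m → c + length xs ≡ e + (m + m)
meander-parity end = 0 , refl
meander-parity {c} (up∷_ {xs = xs} p) with meander-parity p
... | m , eq = m , trans (+-suc c (length xs)) eq
meander-parity {suc c} (down∷_ {xs = xs} {e = e} p) with meander-parity p
... | m , eq = suc m , trans (cong suc (trans (+-suc c (length xs)) (cong suc eq))) (shuffle e m)
  where
  shuffle : ∀ e m → suc (suc (e + (m + m))) ≡ e + (suc m + suc m)
  shuffle = solve-∀

-- Heights are truncated at 0: a step down from 0 stays at 0.
step : ℕ → Step → ℕ
step c up = suc c
step c down = pred c

level : ℕ → List Step → ℕ
level c [] = c
level c (x ∷ xs) = level (step c x) xs

meander-level : ∀ {c xs e} → Meander c xs e → level c xs ≡ e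
meander-level end = refl
meander-level (up∷ p) = meander-level p
meander-level (down∷ p) = meander-level p

data PosChain : ℕ → List ℕ → Set where
  []  : ∀ {c} → PosChain c []
  _∷_ : ∀ {c y ys} → y ≤ c → PosChain (suc y) ys → PosChain c (suc y ∷ ys)

posChain-suc : ∀ {c vs} → PosChain c vs → PosChain (suc c) vs
posChain-suc [] = []
posChain-suc (y≤c ∷ l) = m≤n⇒m≤1+n y≤c ∷ l

lastOr : ℕ → List ℕ → ℕ
lastOr c [] = c
lastOr c (v ∷ vs) = lastOr v vs

-- The path from height c whose up-steps reach the heights vs, each preceded by the necessary descent.
chainSteps : ℕ → List ℕ → List Step
chainSteps c [] = []
chainSteps c (v ∷ vs) = replicate (c ∸ pred v) down ++ up ∷ chainSteps v vs

chainDyck : ℕ → List ℕ → List Step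
chainDyck c vs = chainSteps c vs ++ replicate (lastOr c vs) down

upHeights : ℕ → List Step → List ℕ
upHeights c [] = []
upHeights c (up ∷ xs) = suc c ∷ upHeights (suc c) xs
upHeights c (down ∷ xs) = upHeights (pred c) xs

meander-chainSteps : ∀ {c vs} → PosChain c vs → Meander c (chainSteps c vs) (lastOr c vs)
meander-chainSteps [] = end
meander-chainSteps {c} (_∷_ {y = y} y≤c l) =
  meander-++ (subst (λ z → Meander z (replicate (c ∸ y) down) y) (m∸n+n≡m y≤c) (meander-downs (c ∸ y) y))
             (up∷ meander-chainSteps l)

meander-chainDyck : ∀ {c vs} → PosChain c vs → Meander c (chainDyck c vs) 0
meander-chainDyck {c} {vs} l = meander-++ (meander-chainSteps l)
  (subst (λ z → Meander z (replicate (lastOr c vs) down) 0) (+-identityʳ _) (meander-downs (lastOr c vs) 0))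

pred[m]∸n≡m∸[1+n] : ∀ m n → pred m ∸ n ≡ m ∸ suc n
pred[m]∸n≡m∸[1+n] zero n = 0∸n≡0 n
pred[m]∸n≡m∸[1+n] (suc m) n = refl

upHeights-downs : ∀ n c xs → upHeights c (replicate n down ++ xs) ≡ upHeights (c ∸ n) xs
upHeights-downs zero c xs = refl
upHeights-downs (suc n) c xs = trans (upHeights-downs n (pred c) xs) (cong (λ z → upHeights z xs) (pred[m]∸n≡m∸[1+n] c n))

upHeights-chainSteps-++ : ∀ {c vs} zs → PosChain c vs →
                          upHeights c (chainSteps c vs ++ zs) ≡ vs ++ upHeights (lastOr c vs) zs
upHeights-chainSteps-++ zs [] = refl
upHeights-chainSteps-++ {c} zs (_∷_ {y = y} {ys = ys} y≤c l) = begin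
  upHeights c ((replicate (c ∸ y) down ++ up ∷ chainSteps (suc y) ys) ++ zs)
    ≡⟨ cong (upHeights c) (++-assoc (replicate (c ∸ y) down) (up ∷ chainSteps (suc y) ys) zs) ⟩
  upHeights c (replicate (c ∸ y) down ++ up ∷ (chainSteps (suc y) ys ++ zs))
    ≡⟨ upHeights-downs (c ∸ y) c _ ⟩
  upHeights (c ∸ (c ∸ y)) (up ∷ (chainSteps (suc y) ys ++ zs))
    ≡⟨ cong (λ z → upHeights z (up ∷ (chainSteps (suc y) ys ++ zs))) (m∸[m∸n]≡n y≤c) ⟩
  suc y ∷ upHeights (suc y) (chainSteps (suc y) ys ++ zs)
    ≡⟨ cong (suc y ∷_) (upHeights-chainSteps-++ zs l) ⟩
  suc y ∷ ys ++ upHeights (lastOr (suc y) ys) zs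
    ∎
  where open ≡-Reasoning

upHeights-replicate : ∀ n c → upHeights c (replicate n down) ≡ []
upHeights-replicate n c = trans (cong (upHeights c) (sym (++-identityʳ (replicate n down)))) (upHeights-downs n c [])

upHeights-chainSteps : ∀ {c vs} → PosChain c vs → upHeights c (chainSteps c vs) ≡ vs
upHeights-chainSteps {c} {vs} l = begin
  upHeights c (chainSteps c vs)       ≡⟨ cong (upHeights c) (++-identityʳ (chainSteps c vs)) ⟨
  upHeights c (chainSteps c vs ++ [])  ≡⟨ upHeights-chainSteps-++ [] l ⟩
  vs ++ []                            ≡⟨ ++-identityʳ vs ⟩
  vs                                  ∎
  where open ≡-Reasoning

upHeights-chainDyck : ∀ {c vs} → PosChain c vs → upHeights c (chainDyck c vs) ≡ vs
upHeights-chainDyck {c} {vs} l = begin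
  upHeights c (chainSteps c vs ++ replicate (lastOr c vs) down)
    ≡⟨ upHeights-chainSteps-++ _ l ⟩
  vs ++ upHeights (lastOr c vs) (replicate (lastOr c vs) down)
    ≡⟨ cong (vs ++_) (upHeights-replicate (lastOr c vs) (lastOr c vs)) ⟩
  vs ++ []
    ≡⟨ ++-identityʳ vs ⟩
  vs ∎
  where open ≡-Reasoning

length-chainSteps : ∀ {c vs} → PosChain c vs → length (chainSteps c vs) + lastOr c vs ≡ c + (length vs + length vs)
length-chainSteps {c} [] = sym (+-identityʳ c)
length-chainSteps {c} (_∷_ {y = y} {ys = ys} y≤c l) = begin
  length (replicate (c ∸ y) down ++ up ∷ chainSteps (suc y) ys) + lastOr (suc y) ys
    ≡⟨ cong (_+ lastOr (suc y) ys) (length-++ (replicate (c ∸ y) down)) ⟩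
  (length (replicate (c ∸ y) down) + suc (length (chainSteps (suc y) ys))) + lastOr (suc y) ys
    ≡⟨ cong (λ z → (z + suc (length (chainSteps (suc y) ys))) + lastOr (suc y) ys) (length-replicate (c ∸ y)) ⟩
  ((c ∸ y) + suc (length (chainSteps (suc y) ys))) + lastOr (suc y) ys
    ≡⟨ shuffle₁ (c ∸ y) (length (chainSteps (suc y) ys)) (lastOr (suc y) ys) ⟩
  (c ∸ y) + suc (length (chainSteps (suc y) ys) + lastOr (suc y) ys)
    ≡⟨ cong (λ z → (c ∸ y) + suc z) (length-chainSteps l) ⟩
  (c ∸ y) + suc (suc y + (length ys + length ys))
    ≡⟨ shuffle₂ (c ∸ y) y (length ys) ⟩
  ((c ∸ y) + y) + (suc (length ys) + suc (length ys))
    ≡⟨ cong (_+ (suc (length ys) + suc (length ys))) (m∸n+n≡m y≤c) ⟩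
  c + (suc (length ys) + suc (length ys)) ∎
  where
  open ≡-Reasoning
  shuffle₁ : ∀ a b d → (a + suc b) + d ≡ a + suc (b + d)
  shuffle₁ = solve-∀
  shuffle₂ : ∀ a y n → a + suc (suc y + (n + n)) ≡ (a + y) + (suc n + suc n)
  shuffle₂ = solve-∀

length-chainDyck : ∀ {c vs} → PosChain c vs → length (chainDyck c vs) ≡ c + (length vs + length vs)
length-chainDyck {c} {vs} l = begin
  length (chainSteps c vs ++ replicate (lastOr c vs) down)
    ≡⟨ length-++ (chainSteps c vs) ⟩
  length (chainSteps c vs) + length (replicate (lastOr c vs) down)
    ≡⟨ cong (length (chainSteps c vs) +_) (length-replicate (lastOr c vs)) ⟩
  length (chainSteps c vs) + lastOr c vs
    ≡⟨ length-chainSteps l ⟩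
  c + (length vs + length vs) ∎
  where open ≡-Reasoning

down∷-chainSteps : ∀ {c vs e} → PosChain c vs → e ≤ lastOr c vs →
  down ∷ chainSteps c vs ++ replicate (lastOr c vs ∸ e) down ≡
  chainSteps (suc c) vs ++ replicate (lastOr (suc c) vs ∸ e) down
down∷-chainSteps [] e≤c = cong (λ n → replicate n down) (sym (+-∸-assoc 1 e≤c))
down∷-chainSteps {c} {e = e} (_∷_ {y = y} {ys = ys} y≤c l) _ = begin
  down ∷ (replicate (c ∸ y) down ++ up ∷ chainSteps (suc y) ys) ++ rest
    ≡⟨ cong (down ∷_) (++-assoc (replicate (c ∸ y) down) _ rest) ⟩
  replicate (suc (c ∸ y)) down ++ up ∷ chainSteps (suc y) ys ++ rest
    ≡⟨ cong (λ n → replicate n down ++ up ∷ chainSteps (suc y) ys ++ rest) (+-∸-assoc 1 y≤c) ⟨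
  replicate (suc c ∸ y) down ++ up ∷ chainSteps (suc y) ys ++ rest
    ≡⟨ ++-assoc (replicate (suc c ∸ y) down) _ rest ⟨
  (replicate (suc c ∸ y) down ++ up ∷ chainSteps (suc y) ys) ++ rest ∎
  where
  open ≡-Reasoning
  rest = replicate (lastOr (suc y) ys ∸ e) down

record ChainShape (c : ℕ) (xs : List Step) (e : ℕ) : Set where
  field
    chain : PosChain c (upHeights c xs)
    end≤last : e ≤ lastOr c (upHeights c xs)
    steps : xs ≡ chainSteps c (upHeights c xs) ++ replicate (lastOr c (upHeights c xs) ∸ e) down

meander-shape : ∀ {c xs e} → Meander c xs e → ChainShape c xs e
meander-shape {c} end = record
  { chain = [] ; end≤last = ≤-refl ; steps = cong (λ n → replicate n down) (sym (n∸n≡0 c)) }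
meander-shape {c} (up∷_ {xs = xs} {e = e} p) = record
  { chain = ≤-refl ∷ chain
  ; end≤last = end≤last
  ; steps = trans (cong (up ∷_) steps) (cong (λ n → (replicate n down ++ up ∷ chainSteps (suc c) vs) ++ rest) (sym (n∸n≡0 c)))
  }
  where
  open ChainShape (meander-shape p)
  vs = upHeights (suc c) xs
  rest = replicate (lastOr (suc c) vs ∸ e) down
meander-shape {suc c} (down∷_ {xs = xs} {e = e} p) = record
  { chain = posChain-suc chain
  ; end≤last = ≤-last (upHeights c xs) end≤last
  ; steps = trans (cong (down ∷_) steps) (down∷-chainSteps chain end≤last)
  }
  where
  open ChainShape (meander-shape p)
  ≤-last : ∀ vs → e ≤ lastOr c vs → e ≤ lastOr (suc c) vs
  ≤-last [] e≤c = m≤n⇒m≤1+n e≤c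
  ≤-last (_ ∷ _) e≤v = e≤v

-- Tails: meanders from 0 to an odd height

Split = List Step × List Step

entry : ℕ → ℕ → Step → List Step → Maybe Split
entry j c up xs = if suc c ≡ᵇ j then just ([ up ] , xs) else nothing
entry j c down xs = nothing

-- Splits a path from height c just after its last up-step arriving at height j.
lastEntry : ℕ → ℕ → List Step → Maybe Split
lastEntry j c [] = nothing
lastEntry j c (x ∷ xs) = Maybe.map (map₁ (x ∷_)) (lastEntry j (step c x) xs) <∣> entry j c x xs

lastEntry-∷ : ∀ j c x r {a b} → lastEntry j (step c x) r ≡ just (a , b) → lastEntry j c (x ∷ r) ≡ just (x ∷ a , b)
lastEntry-∷ j c x r eq rewrite eq = refl

lastEntry-here : ∀ j c r → lastEntry j (suc c) r ≡ nothing → suc c ≡ j → lastEntry j c (up ∷ r) ≡ just ([ up ] , r)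
lastEntry-here j c r eq sc≡j rewrite eq with suc c ≡ᵇ j in e
... | true = refl
... | false = ⊥-elim (subst T e (≡⇒≡ᵇ (suc c) j sc≡j))

lastEntry-downs : ∀ j n c r {a b} → lastEntry j (c ∸ n) r ≡ just (a , b) →
                  lastEntry j c (replicate n down ++ r) ≡ just (replicate n down ++ a , b)
lastEntry-downs j zero c r eq = eq
lastEntry-downs j (suc n) c r eq =
  lastEntry-∷ j c down (replicate n down ++ r) (lastEntry-downs j n (pred c) r (trans (cong (λ z → lastEntry j z r) (pred[m]∸n≡m∸[1+n] c n)) eq))

lastEntry-above : ∀ j {m γ e} → Meander m γ e → lastEntry j (m + j) γ ≡ nothing
lastEntry-above j end = refl
lastEntry-above j {m} (up∷ p) rewrite lastEntry-above j p with suc (m + j) ≡ᵇ j in e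
... | true = ⊥-elim (<⇒≢ (s≤s (m≤n+m j m)) (sym (≡ᵇ⇒≡ (suc (m + j)) j (subst T (sym e) _))))
... | false = refl
lastEntry-above j (down∷ p) rewrite lastEntry-above j p = refl

lastEntry-chainSteps : ∀ {c v vs} γ → PosChain c (v ∷ vs) → lastEntry (lastOr v vs) (lastOr v vs) γ ≡ nothing →
                       lastEntry (lastOr v vs) c (chainSteps c (v ∷ vs) ++ γ) ≡ just (chainSteps c (v ∷ vs) , γ)
lastEntry-chainSteps {c} {suc y} {vs} γ (y≤c ∷ l) none
  rewrite ++-assoc (replicate (c ∸ y) down) (up ∷ chainSteps (suc y) vs) γ =
  lastEntry-downs j (c ∸ y) c (up ∷ chainSteps (suc y) vs ++ γ)
    (trans (cong (λ z → lastEntry j z (up ∷ chainSteps (suc y) vs ++ γ)) (m∸[m∸n]≡n y≤c)) (entryAfter vs l none))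
  where
  j = lastOr (suc y) vs
  entryAfter : ∀ vs → PosChain (suc y) vs → lastEntry (lastOr (suc y) vs) (lastOr (suc y) vs) γ ≡ nothing →
               lastEntry (lastOr (suc y) vs) y (up ∷ chainSteps (suc y) vs ++ γ) ≡ just (up ∷ chainSteps (suc y) vs , γ)
  entryAfter [] [] none = lastEntry-here (suc y) y γ none refl
  entryAfter (w ∷ ws) l none = lastEntry-∷ (lastOr w ws) y up (chainSteps (suc y) (w ∷ ws) ++ γ) (lastEntry-chainSteps γ l none)

lastEntry-exists : ∀ {c γ h} j → Meander c γ h → c < j → j ≤ h → lastEntry j c γ ≢ nothing
lastEntry-exists j end c<j j≤h _ = <⇒≱ c<j j≤h
lastEntry-exists {c} j (up∷_ {xs = xs} p) c<j j≤h with lastEntry j (suc c) xs in eq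
... | just _ = λ ()
... | nothing with m≤n⇒m<n∨m≡n c<j
...   | inj₁ sc<j = ⊥-elim (lastEntry-exists j p sc<j j≤h eq)
...   | inj₂ sc≡j with suc c ≡ᵇ j in e
...     | true = λ ()
...     | false = ⊥-elim (subst T e (≡⇒≡ᵇ (suc c) j sc≡j))
lastEntry-exists {suc c} j (down∷_ {xs = xs} p) c<j j≤h with lastEntry j c xs in eq
... | just _ = λ ()
... | nothing = ⊥-elim (lastEntry-exists j p (<-trans (n<1+n c) c<j) j≤h eq)

meander-without-entry : ∀ {c b h} j → Meander c b h → j ≤ c → j ≤ h → lastEntry j c b ≡ nothing →
                        Meander (c ∸ j) b (h ∸ j)
meander-without-entry j end j≤c j≤h none = end
meander-without-entry {c} {h = h} j (up∷_ {xs = xs} p) j≤c j≤h none with lastEntry j (suc c) xs in eq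
... | nothing = up∷ subst (λ z → Meander z xs (h ∸ j)) (+-∸-assoc 1 j≤c)
                          (meander-without-entry j p (m≤n⇒m≤1+n j≤c) j≤h eq)
meander-without-entry {suc c} {h = h} j (down∷_ {xs = xs} p) j≤c j≤h none with lastEntry j c xs in eq
... | nothing with j ≤? c
...   | yes j≤c′ = subst (λ z → Meander z (down ∷ xs) (h ∸ j)) (sym (+-∸-assoc 1 j≤c′))
                     (down∷ meander-without-entry j p j≤c′ j≤h eq)
...   | no j≰c = ⊥-elim (lastEntry-exists j p (≰⇒> j≰c) j≤h eq)

data EndsWithUp : List Step → Set where
  [up] : EndsWithUp [ up ]
  _∷_ : ∀ x {a} → EndsWithUp a → EndsWithUp (x ∷ a)

¬EndsWithUp-downs : ∀ xs n → 0 < n → ¬ EndsWithUp (xs ++ replicate n down)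
¬EndsWithUp-downs [] (suc zero) _ (_ ∷ ())
¬EndsWithUp-downs [] (suc (suc n)) _ (_ ∷ e) = ¬EndsWithUp-downs [] (suc n) z<s e
¬EndsWithUp-downs (x ∷ []) (suc n) _ (_ ∷ e) = ¬EndsWithUp-downs [] (suc n) z<s e
¬EndsWithUp-downs (x ∷ y ∷ xs) (suc n) _ (_ ∷ e) = ¬EndsWithUp-downs (y ∷ xs) (suc n) z<s e

record LastEntry (j c : ℕ) (xs a b : List Step) : Set where
  field
    split : xs ≡ a ++ b
    endsWithUp : EndsWithUp a
    noEntryAfter : lastEntry j j b ≡ nothing
    levelAt : level c a ≡ j

lastEntry-sound : ∀ j c xs {a b} → lastEntry j c xs ≡ just (a , b) → LastEntry j c xs a b
lastEntry-sound j c (x ∷ xs) eq with lastEntry j (step c x) xs in eq′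
lastEntry-sound j c (x ∷ xs) refl | just (a , b) = record
  { split = cong (x ∷_) split ; endsWithUp = x ∷ endsWithUp ; noEntryAfter = noEntryAfter ; levelAt = levelAt }
  where open LastEntry (lastEntry-sound j (step c x) xs eq′)
lastEntry-sound j c (up ∷ xs) eq | nothing with suc c ≡ᵇ j in e
lastEntry-sound j c (up ∷ xs) refl | nothing | true = record
  { split = refl ; endsWithUp = [up] ; noEntryAfter = subst (λ z → lastEntry j z xs ≡ nothing) sc≡j eq′ ; levelAt = sc≡j }
  where
  sc≡j : suc c ≡ j
  sc≡j = ≡ᵇ⇒≡ (suc c) j (subst T (sym e) _)

-- The tail of a path: it climbs along the chain xs to height j, then along the reversed descent of the chain ys to 2j+1.
encodeTail : List ℕ → List ℕ → List Step
encodeTail xs ys = chainSteps 0 xs ++ backwards (chainDyck (suc (lastOr 0 xs)) ys)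

ValidTail : List ℕ → List ℕ → Set
ValidTail xs ys = PosChain 0 xs × PosChain (suc (lastOr 0 xs)) ys

splitTail : ℕ → List Step → Split
splitTail j t = fromMaybe ([] , t) (lastEntry j 0 t)

decodeTail : List Step → List ℕ × List ℕ
decodeTail t = upHeights 0 a , upHeights (suc j) (backwards b)
  where
  j = ⌊ level 0 t /2⌋
  a = proj₁ (splitTail j t)
  b = proj₂ (splitTail j t)

meander-encodeTail : ∀ {xs ys} → ValidTail xs ys → Meander 0 (encodeTail xs ys) (suc (lastOr 0 xs + lastOr 0 xs))
meander-encodeTail {xs} (cx , cy) =
  meander-++ (meander-chainSteps cx) (meander-lift (lastOr 0 xs) (meander-backwards (meander-chainDyck cy)))

level-encodeTail : ∀ {xs ys} → ValidTail xs ys → ⌊ level 0 (encodeTail xs ys) /2⌋ ≡ lastOr 0 xs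
level-encodeTail {xs} v =
  trans (cong ⌊_/2⌋ (meander-level (meander-encodeTail v))) (sym (n≡⌈n+n/2⌉ (lastOr 0 xs)))

splitTail-encodeTail : ∀ {xs ys} → ValidTail xs ys →
  splitTail (lastOr 0 xs) (encodeTail xs ys) ≡ (chainSteps 0 xs , backwards (chainDyck (suc (lastOr 0 xs)) ys))
splitTail-encodeTail {[]} {ys} (_ , cy) =
  cong (λ m → fromMaybe ([] , backwards (chainDyck 1 ys)) m) (lastEntry-above 0 (meander-backwards (meander-chainDyck cy)))
splitTail-encodeTail {v ∷ vs} {ys} (cx , cy) =
  cong (fromMaybe ([] , encodeTail (v ∷ vs) ys))
    (lastEntry-chainSteps _ cx (lastEntry-above (lastOr v vs) (meander-backwards (meander-chainDyck cy))))

decodeTail-encodeTail : ∀ {xs ys} → ValidTail xs ys → decodeTail (encodeTail xs ys) ≡ (xs , ys)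
decodeTail-encodeTail {xs} {ys} v@(cx , cy)
  rewrite level-encodeTail v | splitTail-encodeTail v | backwards-involutive (chainDyck (suc (lastOr 0 xs)) ys) =
  cong₂ _,_ (upHeights-chainSteps cx) (upHeights-chainDyck cy)

dyck-shape : ∀ {c xs} → Meander c xs 0 → xs ≡ chainDyck c (upHeights c xs)
dyck-shape p = ChainShape.steps (meander-shape p)

record TailSplit (j : ℕ) (t a b : List Step) : Set where
  field
    split : t ≡ a ++ b
    splitTail≡ : splitTail j t ≡ (a , b)
    prefix : a ≡ chainSteps 0 (upHeights 0 a)
    chain : PosChain 0 (upHeights 0 a)
    last≡ : lastOr 0 (upHeights 0 a) ≡ j
    suffix : Meander 0 b (suc j)

tailSplit-valid : ∀ {t j a b} → ⌊ level 0 t /2⌋ ≡ j → TailSplit j t a b →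
                  ValidTail (proj₁ (decodeTail t)) (proj₂ (decodeTail t)) × encodeTail (proj₁ (decodeTail t)) (proj₂ (decodeTail t)) ≡ t
tailSplit-valid {t} {j} {a} {b} half≡j ts rewrite half≡j | TailSplit.splitTail≡ ts =
  (chain , subst (λ z → PosChain (suc z) ys) (sym last≡) cy) ,
  (begin
    chainSteps 0 xs ++ backwards (chainDyck (suc (lastOr 0 xs)) ys)
      ≡⟨ cong₂ (λ u w → u ++ backwards (chainDyck (suc w) ys)) (sym prefix) last≡ ⟩
    a ++ backwards (chainDyck (suc j) ys)
      ≡⟨ cong (λ z → a ++ backwards z) (sym (dyck-shape b↓)) ⟩
    a ++ backwards (backwards b)
      ≡⟨ cong (a ++_) (backwards-involutive b) ⟩
    a ++ b
      ≡⟨ sym split ⟩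
    t ∎)
  where
  open TailSplit ts
  open ≡-Reasoning
  xs = upHeights 0 a
  b↓ = meander-backwards suffix
  ys = upHeights (suc j) (backwards b)
  cy : PosChain (suc j) ys
  cy = ChainShape.chain (meander-shape b↓)

chainShape-endsWithUp : ∀ {a j} → EndsWithUp a → ChainShape 0 a j →
                        lastOr 0 (upHeights 0 a) ≡ j × a ≡ chainSteps 0 (upHeights 0 a)
chainShape-endsWithUp {a} {j} ends shape =
  ≤-antisym (m∸n≡0⇒m≤n no-descent) end≤last ,
  trans steps (trans (cong (λ n → chainSteps 0 (upHeights 0 a) ++ replicate n down) no-descent) (++-identityʳ _))
  where
  open ChainShape shape
  no-descent : lastOr 0 (upHeights 0 a) ∸ j ≡ 0
  no-descent = n≤0⇒n≡0 (≮⇒≥ λ 0<d → ¬EndsWithUp-downs _ _ 0<d (subst EndsWithUp steps ends))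

tailSplit-lastEntry : ∀ {t j a b} → Meander 0 t (suc (j + j)) → lastEntry j 0 t ≡ just (a , b) → TailSplit j t a b
tailSplit-lastEntry {t} {j} {a} {b} m e = record
  { split = split
  ; splitTail≡ = cong (fromMaybe ([] , t)) e
  ; prefix = proj₂ last-prefix
  ; chain = ChainShape.chain shape
  ; last≡ = proj₁ last-prefix
  ; suffix = subst₂ (λ u w → Meander u b w) (n∸n≡0 j) (m+n∸n≡m (suc j) j)
               (meander-without-entry j mb ≤-refl (≤-trans (m≤n+m j j) (n≤1+n _)) noEntryAfter)
  }
  where
  open LastEntry (lastEntry-sound j 0 t e)
  halves = meander-split a (subst (λ z → Meander 0 z (suc (j + j))) split m)
  mid≡j : proj₁ halves ≡ j
  mid≡j = trans (sym (meander-level (proj₁ (proj₂ halves)))) levelAt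
  shape : ChainShape 0 a j
  shape = meander-shape (subst (Meander 0 a) mid≡j (proj₁ (proj₂ halves)))
  last-prefix = chainShape-endsWithUp endsWithUp shape
  mb : Meander j b (suc (j + j))
  mb = subst (λ z → Meander z b (suc (j + j))) mid≡j (proj₂ (proj₂ halves))

tailSplit-none : ∀ {t} → Meander 0 t 1 → lastEntry 0 0 t ≡ nothing → TailSplit 0 t [] t
tailSplit-none m e = record
  { split = refl ; splitTail≡ = cong (fromMaybe ([] , _)) e ; prefix = refl ; chain = [] ; last≡ = refl ; suffix = m }

encodeTail-decodeTail : ∀ {t j} → Meander 0 t (suc (j + j)) →
  ValidTail (proj₁ (decodeTail t)) (proj₂ (decodeTail t)) × encodeTail (proj₁ (decodeTail t)) (proj₂ (decodeTail t)) ≡ t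
encodeTail-decodeTail {t} {j} m with lastEntry j 0 t in e
... | just (a , b) = tailSplit-valid half≡j (tailSplit-lastEntry m e)
  where half≡j = trans (cong ⌊_/2⌋ (meander-level m)) (sym (n≡⌈n+n/2⌉ j))
encodeTail-decodeTail {t} {zero} m | nothing = tailSplit-valid (cong ⌊_/2⌋ (meander-level m)) (tailSplit-none m e)
encodeTail-decodeTail {t} {suc j} m | nothing =
  ⊥-elim (lastEntry-exists (suc j) m (s≤s z≤n) (s≤s (≤-trans (m≤m+n j (suc j)) (n≤1+n _))) e)

-- Decomposition of a path into units and a tail

endLevel : ℤ → List Step → ℤ
endLevel i [] = i
endLevel i (up ∷ xs) = endLevel (ℤ.suc i) xs
endLevel i (down ∷ xs) = endLevel (ℤ.pred i) xs

endLevel-++ : ∀ i xs ys → endLevel i (xs ++ ys) ≡ endLevel (endLevel i xs) ys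
endLevel-++ i [] ys = refl
endLevel-++ i (up ∷ xs) ys = endLevel-++ (ℤ.suc i) xs ys
endLevel-++ i (down ∷ xs) ys = endLevel-++ (ℤ.pred i) xs ys

endLevel-meander : ∀ {c xs e} → Meander c xs e → endLevel (ℤ.+ c) xs ≡ ℤ.+ e
endLevel-meander end = refl
endLevel-meander (up∷ p) = endLevel-meander p
endLevel-meander (down∷ p) = endLevel-meander p

endLevel-mirror : ∀ {c xs e} → Meander c (mirror xs) e → endLevel -[1+ c ] xs ≡ -[1+ e ]
endLevel-mirror {xs = []} end = refl
endLevel-mirror {xs = down ∷ xs} (up∷ p) = endLevel-mirror p
endLevel-mirror {xs = up ∷ xs} (down∷ p) = endLevel-mirror p

endLevel-suc : ∀ i xs → endLevel (ℤ.suc i) xs ≡ ℤ.suc (endLevel i xs)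
endLevel-suc i [] = refl
endLevel-suc i (up ∷ xs) = endLevel-suc (ℤ.suc i) xs
endLevel-suc i (down ∷ xs) = begin
  endLevel (ℤ.pred (ℤ.suc i)) xs   ≡⟨ cong (λ j → endLevel j xs) (trans (ℤ.pred-suc i) (sym (ℤ.suc-pred i))) ⟩
  endLevel (ℤ.suc (ℤ.pred i)) xs   ≡⟨ endLevel-suc (ℤ.pred i) xs ⟩
  ℤ.suc (endLevel (ℤ.pred i) xs)   ∎
  where open ≡-Reasoning

endLevel-pred : ∀ i xs → endLevel (ℤ.pred i) xs ≡ ℤ.pred (endLevel i xs)
endLevel-pred i [] = refl
endLevel-pred i (down ∷ xs) = endLevel-pred (ℤ.pred i) xs
endLevel-pred i (up ∷ xs) = begin
  endLevel (ℤ.suc (ℤ.pred i)) xs   ≡⟨ cong (λ j → endLevel j xs) (trans (ℤ.suc-pred i) (sym (ℤ.pred-suc i))) ⟩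
  endLevel (ℤ.pred (ℤ.suc i)) xs   ≡⟨ endLevel-pred (ℤ.suc i) xs ⟩
  ℤ.pred (endLevel (ℤ.suc i) xs)   ∎
  where open ≡-Reasoning

-- A unit (a , b) stands for the excursion a ++ down ∷ b ++ [ up ]: a stays ≥ 0 and b stays ≤ -1.
Unit = List Step × List Step

flattenUnits : List Unit → List Step → List Step
flattenUnits [] t = t
flattenUnits ((a , b) ∷ us) t = a ++ down ∷ b ++ up ∷ flattenUnits us t

ValidUnits : ℕ → List Unit → List Step → Set
ValidUnits h [] t = ∃ λ e → Meander h t e
ValidUnits h ((a , b) ∷ us) t = Meander h a 0 × Meander 0 (mirror b) 0 × ValidUnits 0 us t

Decomposition = List Unit × List Step

flatten : Decomposition → List Step
flatten (us , t) = flattenUnits us t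

consAbove : Step → Decomposition → Decomposition
consAbove x ([] , t) = ([] , x ∷ t)
consAbove x ((a , b) ∷ us , t) = ((x ∷ a , b) ∷ us , t)

prependAbove : List Step → Decomposition → Decomposition
prependAbove s ([] , t) = ([] , s ++ t)
prependAbove s ((a , b) ∷ us , t) = ((s ++ a , b) ∷ us , t)

consAbove-prependAbove : ∀ x s d → consAbove x (prependAbove s d) ≡ prependAbove (x ∷ s) d
consAbove-prependAbove x s ([] , t) = refl
consAbove-prependAbove x s ((a , b) ∷ us , t) = refl

-- Parsing from height h ≥ 0 (parseAbove) or from height -(d+1) (parseBelow); the latter also returns the unit's lower part.
mutual
  parseAbove : ℕ → List Step → Decomposition
  parseAbove h [] = ([] , [])
  parseAbove h (up ∷ xs) = consAbove up (parseAbove (suc h) xs)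
  parseAbove (suc h) (down ∷ xs) = consAbove down (parseAbove h xs)
  parseAbove zero (down ∷ xs) with parseBelow zero xs
  ... | b , us , t = ([] , b) ∷ us , t

  parseBelow : ℕ → List Step → List Step × Decomposition
  parseBelow d [] = [] , [] , []
  parseBelow d (down ∷ xs) = map₁ (down ∷_) (parseBelow (suc d) xs)
  parseBelow zero (up ∷ xs) = [] , parseAbove zero xs
  parseBelow (suc d) (up ∷ xs) = map₁ (up ∷_) (parseBelow d xs)

flatten-consAbove : ∀ x d → flatten (consAbove x d) ≡ x ∷ flatten d
flatten-consAbove x ([] , t) = refl
flatten-consAbove x ((a , b) ∷ us , t) = refl

mutual
  flatten-parseAbove : ∀ h xs → 0ℤ ℤ.≤ endLevel (ℤ.+ h) xs → flatten (parseAbove h xs) ≡ xs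
  flatten-parseAbove h [] _ = refl
  flatten-parseAbove h (up ∷ xs) nn =
    trans (flatten-consAbove up (parseAbove (suc h) xs)) (cong (up ∷_) (flatten-parseAbove (suc h) xs nn))
  flatten-parseAbove (suc h) (down ∷ xs) nn =
    trans (flatten-consAbove down (parseAbove h xs)) (cong (down ∷_) (flatten-parseAbove h xs nn))
  flatten-parseAbove zero (down ∷ xs) nn with parseBelow zero xs | flatten-parseBelow zero xs nn
  ... | b , us , t | eq = cong (down ∷_) eq

  flatten-parseBelow : ∀ d xs → 0ℤ ℤ.≤ endLevel -[1+ d ] xs →
                       proj₁ (parseBelow d xs) ++ up ∷ flatten (proj₂ (parseBelow d xs)) ≡ xs
  flatten-parseBelow d [] ()
  flatten-parseBelow d (down ∷ xs) nn = cong (down ∷_) (flatten-parseBelow (suc d) xs nn)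
  flatten-parseBelow zero (up ∷ xs) nn = cong (up ∷_) (flatten-parseAbove zero xs nn)
  flatten-parseBelow (suc d) (up ∷ xs) nn = cong (up ∷_) (flatten-parseBelow d xs nn)

ValidAbove : ℕ → Decomposition → Set
ValidAbove h (us , t) = ValidUnits h us t

valid-consUp : ∀ h d → ValidAbove (suc h) d → ValidAbove h (consAbove up d)
valid-consUp h ([] , t) (e , m) = e , up∷ m
valid-consUp h ((a , b) ∷ us , t) (m , v) = up∷ m , v

valid-consDown : ∀ h d → ValidAbove h d → ValidAbove (suc h) (consAbove down d)
valid-consDown h ([] , t) (e , m) = e , down∷ m
valid-consDown h ((a , b) ∷ us , t) (m , v) = down∷ m , v

mutual
  valid-parseAbove : ∀ h xs → 0ℤ ℤ.≤ endLevel (ℤ.+ h) xs → ValidAbove h (parseAbove h xs)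
  valid-parseAbove h [] _ = h , end
  valid-parseAbove h (up ∷ xs) nn = valid-consUp h (parseAbove (suc h) xs) (valid-parseAbove (suc h) xs nn)
  valid-parseAbove (suc h) (down ∷ xs) nn = valid-consDown h (parseAbove h xs) (valid-parseAbove h xs nn)
  valid-parseAbove zero (down ∷ xs) nn with parseBelow zero xs | valid-parseBelow zero xs nn
  ... | b , us , t | mb , v = end , mb , v

  valid-parseBelow : ∀ d xs → 0ℤ ℤ.≤ endLevel -[1+ d ] xs →
                     Meander d (mirror (proj₁ (parseBelow d xs))) 0 × ValidAbove 0 (proj₂ (parseBelow d xs))
  valid-parseBelow d [] ()
  valid-parseBelow d (down ∷ xs) nn with parseBelow (suc d) xs | valid-parseBelow (suc d) xs nn
  ... | b , _ | mb , v = up∷ mb , v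
  valid-parseBelow zero (up ∷ xs) nn = end , valid-parseAbove zero xs nn
  valid-parseBelow (suc d) (up ∷ xs) nn with parseBelow d xs | valid-parseBelow d xs nn
  ... | b , _ | mb , v = down∷ mb , v

parseAbove-meander : ∀ {h s e} rest → Meander h s e → parseAbove h (s ++ rest) ≡ prependAbove s (parseAbove e rest)
parseAbove-meander rest end = sym (prependAbove-[] (parseAbove _ rest))
  where
  prependAbove-[] : ∀ d → prependAbove [] d ≡ d
  prependAbove-[] ([] , t) = refl
  prependAbove-[] ((a , b) ∷ us , t) = refl
parseAbove-meander {s = up ∷ s} rest (up∷ m) =
  trans (cong (consAbove up) (parseAbove-meander rest m)) (consAbove-prependAbove up s _)
parseAbove-meander {s = down ∷ s} rest (down∷ m) =
  trans (cong (consAbove down) (parseAbove-meander rest m)) (consAbove-prependAbove down s _)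

parseBelow-mirror : ∀ {d b} rest → Meander d (mirror b) 0 → parseBelow d (b ++ up ∷ rest) ≡ (b , parseAbove 0 rest)
parseBelow-mirror {b = []} rest end = refl
parseBelow-mirror {b = down ∷ b} rest (up∷ m) rewrite parseBelow-mirror rest m = refl
parseBelow-mirror {suc d} {b = up ∷ b} rest (down∷ m) rewrite parseBelow-mirror rest m = refl

parseAbove-flattenUnits : ∀ us t → ValidUnits 0 us t → parseAbove 0 (flattenUnits us t) ≡ (us , t)
parseAbove-flattenUnits [] t (e , m) = begin
  parseAbove 0 t                          ≡⟨ cong (parseAbove 0) (++-identityʳ t) ⟨
  parseAbove 0 (t ++ [])                  ≡⟨ parseAbove-meander [] m ⟩
  ([] , t ++ [])                          ≡⟨ cong ([] ,_) (++-identityʳ t) ⟩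
  ([] , t)                                ∎
  where open ≡-Reasoning
parseAbove-flattenUnits ((a , b) ∷ us) t (ma , mb , v) = begin
  parseAbove 0 (a ++ down ∷ b ++ up ∷ flattenUnits us t)
    ≡⟨ parseAbove-meander (down ∷ b ++ up ∷ flattenUnits us t) ma ⟩
  prependAbove a (parseAbove 0 (down ∷ b ++ up ∷ flattenUnits us t))
    ≡⟨ cong (λ p → prependAbove a (([] , proj₁ p) ∷ proj₁ (proj₂ p) , proj₂ (proj₂ p))) (parseBelow-mirror (flattenUnits us t) mb) ⟩
  ((a ++ [] , b) ∷ proj₁ (parseAbove 0 (flattenUnits us t)) , proj₂ (parseAbove 0 (flattenUnits us t)))
    ≡⟨ cong₂ (λ a′ d → ((a′ , b) ∷ proj₁ d , proj₂ d)) (++-identityʳ a) (parseAbove-flattenUnits us t v) ⟩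
  ((a , b) ∷ us , t) ∎
  where open ≡-Reasoning

endLevel-flattenUnits : ∀ us t → ValidUnits 0 us t → endLevel 0ℤ (flattenUnits us t) ≡ endLevel 0ℤ t
endLevel-flattenUnits [] t _ = refl
endLevel-flattenUnits ((a , b) ∷ us) t (ma , mb , v) = begin
  endLevel 0ℤ (a ++ down ∷ b ++ up ∷ flattenUnits us t)
    ≡⟨ endLevel-++ 0ℤ a _ ⟩
  endLevel (endLevel 0ℤ a) (down ∷ b ++ up ∷ flattenUnits us t)
    ≡⟨ cong (λ i → endLevel i (down ∷ b ++ up ∷ flattenUnits us t)) (endLevel-meander ma) ⟩
  endLevel -[1+ 0 ] (b ++ up ∷ flattenUnits us t)
    ≡⟨ endLevel-++ -[1+ 0 ] b _ ⟩
  endLevel (endLevel -[1+ 0 ] b) (up ∷ flattenUnits us t)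
    ≡⟨ cong (λ i → endLevel i (up ∷ flattenUnits us t)) (endLevel-mirror mb) ⟩
  endLevel 0ℤ (flattenUnits us t)
    ≡⟨ endLevel-flattenUnits us t v ⟩
  endLevel 0ℤ t ∎
  where open ≡-Reasoning

validUnits-tail : ∀ us t → ValidUnits 0 us t → ∃ λ e → Meander 0 t e
validUnits-tail [] t v = v
validUnits-tail ((a , b) ∷ us) t (_ , _ , v) = validUnits-tail us t v

even-or-odd : ∀ n → (∃ λ j → n ≡ j + j) ⊎ (∃ λ j → n ≡ suc (j + j))
even-or-odd zero = inj₁ (0 , refl)
even-or-odd (suc n) with even-or-odd n
... | inj₁ (j , e) = inj₂ (j , cong suc e)
... | inj₂ (j , e) = inj₁ (suc j , trans (cong suc e) (cong suc (sym (+-suc j j))))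

odd-minus-even : ∀ a m k → a + (m + m) ≡ suc (k + k) → ∃ λ j → a ≡ suc (j + j)
odd-minus-even a m k eq with even-or-odd a
... | inj₂ odd = odd
... | inj₁ (j , e) = ⊥-elim (even≢odd (j + m) k (begin
  2 * (j + m)          ≡⟨ shuffle j m ⟩
  (j + j) + (m + m)    ≡⟨ cong (_+ (m + m)) e ⟨
  a + (m + m)          ≡⟨ eq ⟩
  suc (k + k)          ≡⟨ cong (λ z → suc (k + z)) (+-identityʳ k) ⟨
  suc (2 * k)          ∎))
  where
  open ≡-Reasoning
  shuffle : ∀ j m → 2 * (j + m) ≡ (j + j) + (m + m)
  shuffle = solve-∀

double-≤ : ∀ {i b} → i + i ≤ b + b → i ≤ b
double-≤ {i} {b} 2i≤2b with i ≤? b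
... | yes i≤b = i≤b
... | no i≰b = ⊥-elim (<⇒≱ (+-mono-< (≰⇒> i≰b) (≰⇒> i≰b)) 2i≤2b)

ChainPair = List ℕ × List ℕ

ValidPair : ChainPair → Set
ValidPair u = PosChain 0 (proj₁ u) × PosChain 0 (proj₂ u)

encodeUnit : ChainPair → Unit
encodeUnit (p , n) = chainDyck 0 p , mirror (chainDyck 0 n)

decodeUnit : Unit → ChainPair
decodeUnit (a , b) = upHeights 0 a , upHeights 0 (mirror b)

record State : Set where
  constructor state
  field
    initialYs : List ℕ
    blocks : List ChainPair
    finalXs : List ℕ

ValidState : State → Set
ValidState (state ys us xs) = ValidTail xs ys × All ValidPair us

encodePath : State → List Step
encodePath (state ys us xs) = flattenUnits (map encodeUnit us) (encodeTail xs ys)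

decodeDecomposition : Decomposition → State
decodeDecomposition (us , t) = state (proj₂ (decodeTail t)) (map decodeUnit us) (proj₁ (decodeTail t))

decodePath : List Step → State
decodePath q = decodeDecomposition (parseAbove 0 q)

validUnits-encode : ∀ us t → All ValidPair us → (∃ λ e → Meander 0 t e) → ValidUnits 0 (map encodeUnit us) t
validUnits-encode [] t [] m = m
validUnits-encode ((p , n) ∷ us) t ((cp , cn) ∷ v) m =
  meander-chainDyck cp , subst (λ z → Meander 0 z 0) (sym (mirror-involutive (chainDyck 0 n))) (meander-chainDyck cn) ,
  validUnits-encode us t v m

decodeUnit-encodeUnit : ∀ {u} → ValidPair u → decodeUnit (encodeUnit u) ≡ u
decodeUnit-encodeUnit {p , n} (cp , cn) =
  cong₂ _,_ (upHeights-chainDyck cp) (trans (cong (upHeights 0) (mirror-involutive (chainDyck 0 n))) (upHeights-chainDyck cn))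

map-decodeUnit-encodeUnit : ∀ {us} → All ValidPair us → map decodeUnit (map encodeUnit us) ≡ us
map-decodeUnit-encodeUnit [] = refl
map-decodeUnit-encodeUnit (v ∷ vs) = cong₂ _∷_ (decodeUnit-encodeUnit v) (map-decodeUnit-encodeUnit vs)

validUnits-encodeTail : ∀ {st} → ValidState st →
  ValidUnits 0 (map encodeUnit (State.blocks st)) (encodeTail (State.finalXs st) (State.initialYs st))
validUnits-encodeTail {state ys us xs} (vt , vp) = validUnits-encode us _ vp (_ , meander-encodeTail vt)

decodePath-encodePath : ∀ {st} → ValidState st → decodePath (encodePath st) ≡ st
decodePath-encodePath {st@(state ys us xs)} v@(vt , vp) = begin
  decodeDecomposition (parseAbove 0 (flattenUnits (map encodeUnit us) (encodeTail xs ys)))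
    ≡⟨ cong decodeDecomposition (parseAbove-flattenUnits _ _ (validUnits-encodeTail {st} v)) ⟩
  decodeDecomposition (map encodeUnit us , encodeTail xs ys)
    ≡⟨ cong₂ (λ d u → state (proj₂ d) u (proj₁ d)) (decodeTail-encodeTail vt) (map-decodeUnit-encodeUnit vp) ⟩
  state ys us xs ∎
  where open ≡-Reasoning

encodeUnit-decodeUnits : ∀ us t → ValidUnits 0 us t →
  map encodeUnit (map decodeUnit us) ≡ us × All ValidPair (map decodeUnit us)
encodeUnit-decodeUnits [] t v = refl , []
encodeUnit-decodeUnits ((a , b) ∷ us) t (ma , mb , v) with encodeUnit-decodeUnits us t v
... | eq , vs =
  cong₂ _∷_ (cong₂ _,_ (sym (dyck-shape ma))
                       (trans (cong mirror (sym (dyck-shape mb))) (mirror-involutive b))) eq ,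
  (ChainShape.chain (meander-shape ma) , ChainShape.chain (meander-shape mb)) ∷ vs

length-flattenUnits : ∀ us t → ValidUnits 0 us t → ∃ λ m → length (flattenUnits us t) ≡ (m + m) + length t
length-flattenUnits [] t v = 0 , refl
length-flattenUnits ((a , b) ∷ us) t (ma , mb , v)
  with meander-parity ma | meander-parity mb | length-flattenUnits us t v
... | i , ei | j , ej | m , em = suc (i + j + m) , (begin
  length (a ++ down ∷ b ++ up ∷ flattenUnits us t)
    ≡⟨ length-++ a ⟩
  length a + suc (length (b ++ up ∷ flattenUnits us t))
    ≡⟨ cong (λ z → length a + suc z) (length-++ b) ⟩
  length a + suc (length b + suc (length (flattenUnits us t)))
    ≡⟨ cong₂ (λ u w → u + suc (w + suc (length (flattenUnits us t)))) ei (trans (sym (length-mirror b)) ej) ⟩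
  (i + i) + suc ((j + j) + suc (length (flattenUnits us t)))
    ≡⟨ cong (λ z → (i + i) + suc ((j + j) + suc z)) em ⟩
  (i + i) + suc ((j + j) + suc ((m + m) + length t))
    ≡⟨ shuffle i j m (length t) ⟩
  (suc (i + j + m) + suc (i + j + m)) + length t ∎)
  where
  open ≡-Reasoning
  shuffle : ∀ a b m t → (a + a) + suc ((b + b) + suc ((m + m) + t)) ≡ (suc (a + b + m) + suc (a + b + m)) + t
  shuffle = solve-∀

-- Units have even length, so the tail has odd length and therefore ends at an odd height.
tail-odd : ∀ us t k → ValidUnits 0 us t → length (flattenUnits us t) ≡ suc (k + k) → ∃ λ j → Meander 0 t (suc (j + j))
tail-odd us t k v len = proj₁ e-odd , subst (Meander 0 t) (proj₂ e-odd) mt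
  where
  e = proj₁ (validUnits-tail us t v)
  mt = proj₂ (validUnits-tail us t v)
  u = proj₁ (length-flattenUnits us t v)
  w = proj₁ (meander-parity mt)
  shuffle : ∀ e w u → e + ((w + u) + (w + u)) ≡ (e + (w + w)) + (u + u)
  shuffle = solve-∀
  e-odd = odd-minus-even e (w + u) k (begin
    e + ((w + u) + (w + u))          ≡⟨ shuffle e w u ⟩
    (e + (w + w)) + (u + u)          ≡⟨ cong (_+ (u + u)) (proj₂ (meander-parity mt)) ⟨
    length t + (u + u)               ≡⟨ +-comm (length t) (u + u) ⟩
    (u + u) + length t               ≡⟨ proj₂ (length-flattenUnits us t v) ⟨
    length (flattenUnits us t)       ≡⟨ len ⟩
    suc (k + k)                      ∎)
    where open ≡-Reasoning

encodePath-decodePath : ∀ q k → length q ≡ suc (k + k) → 0ℤ ℤ.≤ endLevel 0ℤ q →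
                        encodePath (decodePath q) ≡ q × ValidState (decodePath q)
encodePath-decodePath q k len nn = trans (cong₂ flattenUnits (proj₁ units) (proj₂ tail′)) flat , proj₁ tail′ , proj₂ units
  where
  us = proj₁ (parseAbove 0 q)
  t = proj₂ (parseAbove 0 q)
  valid = valid-parseAbove 0 q nn
  flat = flatten-parseAbove 0 q nn
  odd = tail-odd us t k valid (trans (cong length flat) len)
  tail′ = encodeTail-decodeTail {j = proj₁ odd} (proj₂ odd)
  units = encodeUnit-decodeUnits us t valid

pairSize : ChainPair → ℕ
pairSize (p , n) = suc (length p + length n)

size : State → ℕ
size (state ys us xs) = length ys + sum (map pairSize us) + length xs

length-encodeTail : ∀ {xs ys} → ValidTail xs ys → length (encodeTail xs ys) ≡ suc ((length xs + length ys) + (length xs + length ys))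
length-encodeTail {xs} {ys} (cx , cy) = begin
  length (chainSteps 0 xs ++ backwards (chainDyck (suc j) ys))
    ≡⟨ length-++ (chainSteps 0 xs) ⟩
  length (chainSteps 0 xs) + length (backwards (chainDyck (suc j) ys))
    ≡⟨ cong (length (chainSteps 0 xs) +_) (trans (length-backwards (chainDyck (suc j) ys)) (length-chainDyck cy)) ⟩
  length (chainSteps 0 xs) + (suc j + (length ys + length ys))
    ≡⟨ shuffle₁ (length (chainSteps 0 xs)) j (length ys) ⟩
  (length (chainSteps 0 xs) + j) + suc (length ys + length ys)
    ≡⟨ cong (_+ suc (length ys + length ys)) (length-chainSteps cx) ⟩
  (length xs + length xs) + suc (length ys + length ys)
    ≡⟨ shuffle₂ (length xs) (length ys) ⟩
  suc ((length xs + length ys) + (length xs + length ys)) ∎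
  where
  open ≡-Reasoning
  j = lastOr 0 xs
  shuffle₁ : ∀ b j n → b + (suc j + (n + n)) ≡ (b + j) + suc (n + n)
  shuffle₁ = solve-∀
  shuffle₂ : ∀ a n → (a + a) + suc (n + n) ≡ suc ((a + n) + (a + n))
  shuffle₂ = solve-∀

length-encodeUnits : ∀ us t → All ValidPair us →
  length (flattenUnits (map encodeUnit us) t) ≡ (sum (map pairSize us) + sum (map pairSize us)) + length t
length-encodeUnits [] t [] = refl
length-encodeUnits ((p , n) ∷ us) t ((cp , cn) ∷ v) = begin
  length (chainDyck 0 p ++ down ∷ mirror (chainDyck 0 n) ++ up ∷ rest)
    ≡⟨ length-++ (chainDyck 0 p) ⟩
  length (chainDyck 0 p) + suc (length (mirror (chainDyck 0 n) ++ up ∷ rest))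
    ≡⟨ cong (λ z → length (chainDyck 0 p) + suc z) (length-++ (mirror (chainDyck 0 n))) ⟩
  length (chainDyck 0 p) + suc (length (mirror (chainDyck 0 n)) + suc (length rest))
    ≡⟨ cong₂ (λ a b → a + suc (b + suc (length rest)))
             (length-chainDyck cp) (trans (length-mirror (chainDyck 0 n)) (length-chainDyck cn)) ⟩
  (length p + length p) + suc ((length n + length n) + suc (length rest))
    ≡⟨ cong (λ z → (length p + length p) + suc ((length n + length n) + suc z)) (length-encodeUnits us t v) ⟩
  (length p + length p) + suc ((length n + length n) + suc ((S + S) + length t))
    ≡⟨ shuffle (length p) (length n) S (length t) ⟩
  (suc (length p + length n + S) + suc (length p + length n + S)) + length t ∎
  where
  open ≡-Reasoning
  rest = flattenUnits (map encodeUnit us) t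
  S = sum (map pairSize us)
  shuffle : ∀ a b u t → (a + a) + suc ((b + b) + suc ((u + u) + t)) ≡ (suc (a + b + u) + suc (a + b + u)) + t
  shuffle = solve-∀

length-encodePath : ∀ {st} → ValidState st → length (encodePath st) ≡ suc (size st + size st)
length-encodePath {state ys us xs} (vt , vp) = begin
  length (flattenUnits (map encodeUnit us) (encodeTail xs ys))
    ≡⟨ length-encodeUnits us (encodeTail xs ys) vp ⟩
  (S + S) + length (encodeTail xs ys)
    ≡⟨ cong ((S + S) +_) (length-encodeTail vt) ⟩
  (S + S) + suc ((length xs + length ys) + (length xs + length ys))
    ≡⟨ shuffle S (length xs) (length ys) ⟩
  suc ((length ys + S + length xs) + (length ys + S + length xs)) ∎
  where
  open ≡-Reasoning
  S = sum (map pairSize us)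
  shuffle : ∀ u a b → (u + u) + suc ((a + b) + (a + b)) ≡ suc ((b + u + a) + (b + u + a))
  shuffle = solve-∀

endLevel-encodePath : ∀ {st} → ValidState st → ∃ λ e → endLevel 0ℤ (encodePath st) ≡ ℤ.+ suc e
endLevel-encodePath {st@(state ys us xs)} v@(vt , _) =
  _ , trans (endLevel-flattenUnits _ _ (validUnits-encodeTail {st} v)) (endLevel-meander (meander-encodeTail vt))

-- Column sequences

-- The column (x , y) records the heights of the residues 2i and 2i - 1.
Column = ℕ × ℕ

xCol : ℕ → Column
xCol x = x , 0

yCol : ℕ → Column
yCol y = 0 , y

unitColumns : List ChainPair → List Column
unitColumns [] = []
unitColumns ((p , n) ∷ us) = map xCol p ++ (0 , 0) ∷ map yCol n ++ unitColumns us

columns : State → List Column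
columns (state ys us xs) = map yCol ys ++ unitColumns us ++ map xCol xs

pushColumn : Column → State → State
pushColumn (zero , zero) (state ys us xs) = state [] (([] , ys) ∷ us) xs
pushColumn (zero , suc y) (state ys us xs) = state (suc y ∷ ys) us xs
pushColumn (suc x , _) (state _ [] xs) = state [] [] (suc x ∷ xs)
pushColumn (suc x , _) (state _ ((p , n) ∷ us) xs) = state [] ((suc x ∷ p , n) ∷ us) xs

decodeColumns : List Column → State
decodeColumns = foldr pushColumn (state [] [] [])

Positive : List ℕ → Set
Positive = All (0 <_)

PositivePairs : List ChainPair → Set
PositivePairs = All (λ u → Positive (proj₁ u) × Positive (proj₂ u))

PositiveState : State → Set
PositiveState (state ys us xs) = Positive ys × PositivePairs us × Positive xs

positive-decodeColumns : ∀ cs → PositiveState (decodeColumns cs)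
positive-decodeColumns [] = [] , [] , []
positive-decodeColumns (c ∷ cs) = push c (decodeColumns cs) (positive-decodeColumns cs)
  where
  push : ∀ c st → PositiveState st → PositiveState (pushColumn c st)
  push (zero , zero) (state ys us xs) (py , pu , px) = [] , ([] , py) ∷ pu , px
  push (zero , suc y) (state ys us xs) (py , pu , px) = z<s ∷ py , pu , px
  push (suc x , _) (state _ [] xs) (_ , _ , px) = [] , [] , z<s ∷ px
  push (suc x , _) (state _ ((p , n) ∷ us) xs) (_ , (pp , pn) ∷ pu , px) = [] , (z<s ∷ pp , pn) ∷ pu , px

pushYs : ∀ {ys} zs us xs → Positive ys → foldr pushColumn (state zs us xs) (map yCol ys) ≡ state (ys ++ zs) us xs
pushYs zs us xs [] = refl
pushYs zs us xs (z<s ∷ py) rewrite pushYs zs us xs py = refl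

pushXs-final : ∀ {p} xs → Positive p → foldr pushColumn (state [] [] xs) (map xCol p) ≡ state [] [] (p ++ xs)
pushXs-final xs [] = refl
pushXs-final xs (z<s ∷ pp) rewrite pushXs-final xs pp = refl

pushXs-unit : ∀ {p} q n us xs → Positive p →
              foldr pushColumn (state [] ((q , n) ∷ us) xs) (map xCol p) ≡ state [] ((p ++ q , n) ∷ us) xs
pushXs-unit q n us xs [] = refl
pushXs-unit q n us xs (z<s ∷ pp) rewrite pushXs-unit q n us xs pp = refl

decodeColumns-unitColumns : ∀ us xs → PositivePairs us → Positive xs →
                            decodeColumns (unitColumns us ++ map xCol xs) ≡ state [] us xs
decodeColumns-unitColumns [] xs [] px = trans (pushXs-final [] px) (cong (state [] []) (++-identityʳ _))
decodeColumns-unitColumns ((p , n) ∷ us) xs ((pp , pn) ∷ pu) px = begin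
  decodeColumns ((map xCol p ++ (0 , 0) ∷ map yCol n ++ unitColumns us) ++ map xCol xs)
    ≡⟨ cong decodeColumns (++-assoc (map xCol p) _ _) ⟩
  decodeColumns (map xCol p ++ (0 , 0) ∷ (map yCol n ++ unitColumns us) ++ map xCol xs)
    ≡⟨ cong (λ cs → decodeColumns (map xCol p ++ (0 , 0) ∷ cs)) (++-assoc (map yCol n) _ _) ⟩
  decodeColumns (map xCol p ++ (0 , 0) ∷ map yCol n ++ unitColumns us ++ map xCol xs)
    ≡⟨ foldr-++ pushColumn _ (map xCol p) _ ⟩
  foldr pushColumn (pushColumn (0 , 0) (decodeColumns (map yCol n ++ unitColumns us ++ map xCol xs))) (map xCol p)
    ≡⟨ cong (λ st → foldr pushColumn (pushColumn (0 , 0) st) (map xCol p)) (foldr-++ pushColumn _ (map yCol n) _) ⟩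
  foldr pushColumn (pushColumn (0 , 0) (foldr pushColumn (decodeColumns (unitColumns us ++ map xCol xs)) (map yCol n))) (map xCol p)
    ≡⟨ cong (λ st → foldr pushColumn (pushColumn (0 , 0) (foldr pushColumn st (map yCol n))) (map xCol p))
            (decodeColumns-unitColumns us xs pu px) ⟩
  foldr pushColumn (pushColumn (0 , 0) (foldr pushColumn (state [] us xs) (map yCol n))) (map xCol p)
    ≡⟨ cong (λ st → foldr pushColumn (pushColumn (0 , 0) st) (map xCol p)) (pushYs [] us xs pn) ⟩
  foldr pushColumn (state [] (([] , n ++ []) ∷ us) xs) (map xCol p)
    ≡⟨ pushXs-unit [] (n ++ []) us xs pp ⟩
  state [] ((p ++ [] , n ++ []) ∷ us) xs
    ≡⟨ cong₂ (λ a b → state [] ((a , b) ∷ us) xs) (++-identityʳ p) (++-identityʳ n) ⟩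
  state [] ((p , n) ∷ us) xs ∎
  where open ≡-Reasoning

decodeColumns-columns : ∀ st → PositiveState st → decodeColumns (columns st) ≡ st
decodeColumns-columns (state ys us xs) (py , pu , px) = begin
  decodeColumns (map yCol ys ++ unitColumns us ++ map xCol xs)
    ≡⟨ foldr-++ pushColumn _ (map yCol ys) _ ⟩
  foldr pushColumn (decodeColumns (unitColumns us ++ map xCol xs)) (map yCol ys)
    ≡⟨ cong (λ st → foldr pushColumn st (map yCol ys)) (decodeColumns-unitColumns us xs pu px) ⟩
  foldr pushColumn (state [] us xs) (map yCol ys)
    ≡⟨ pushYs [] us xs py ⟩
  state (ys ++ []) us xs
    ≡⟨ cong (λ zs → state zs us xs) (++-identityʳ ys) ⟩
  state ys us xs ∎
  where open ≡-Reasoning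

-- No two consecutive integers: a positive x-height forces the y-heights of its own and of the next column to be 0.
HeadY≡0 : List Column → Set
HeadY≡0 [] = ⊤
HeadY≡0 ((_ , y) ∷ _) = y ≡ 0

Separated : List Column → Set
Separated [] = ⊤
Separated ((zero , _) ∷ cs) = Separated cs
Separated ((suc _ , y) ∷ cs) = y ≡ 0 × HeadY≡0 cs × Separated cs

initialYs-decodeColumns : ∀ cs → HeadY≡0 cs → State.initialYs (decodeColumns cs) ≡ []
initialYs-decodeColumns [] _ = refl
initialYs-decodeColumns ((zero , zero) ∷ cs) _ = refl
initialYs-decodeColumns ((suc x , y) ∷ cs) _ with decodeColumns cs
... | state _ [] _ = refl
... | state _ (_ ∷ _) _ = refl

columns-pushX : ∀ x y st → State.initialYs st ≡ [] → columns (pushColumn (suc x , y) st) ≡ xCol (suc x) ∷ columns st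
columns-pushX x y (state [] [] xs) refl = refl
columns-pushX x y (state [] ((p , n) ∷ us) xs) refl = refl

columns-decodeColumns : ∀ cs → Separated cs → columns (decodeColumns cs) ≡ cs
columns-decodeColumns [] _ = refl
columns-decodeColumns ((zero , zero) ∷ cs) sep with decodeColumns cs | columns-decodeColumns cs sep
... | state ys us xs | eq = cong ((0 , 0) ∷_) (trans (++-assoc (map yCol ys) _ _) eq)
columns-decodeColumns ((zero , suc y) ∷ cs) sep with decodeColumns cs | columns-decodeColumns cs sep
... | state ys us xs | eq = cong ((0 , suc y) ∷_) eq
columns-decodeColumns ((suc x , y) ∷ cs) (refl , head , sep) =
  trans (columns-pushX x y (decodeColumns cs) (initialYs-decodeColumns cs head))
        (cong (xCol (suc x) ∷_) (columns-decodeColumns cs sep))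

separated-xCols : ∀ {p} rest → Positive p → HeadY≡0 rest → Separated rest → Separated (map xCol p ++ rest)
separated-xCols rest [] _ sep = sep
separated-xCols rest (z<s ∷ []) head sep = refl , head , sep
separated-xCols rest (z<s ∷ pp@(z<s ∷ _)) head sep = refl , refl , separated-xCols rest pp head sep

separated-yCols : ∀ ys rest → Separated rest → Separated (map yCol ys ++ rest)
separated-yCols [] rest sep = sep
separated-yCols (y ∷ ys) rest sep = separated-yCols ys rest sep

separated-columns : ∀ st → PositiveState st → Separated (columns st)
separated-columns (state ys us xs) (_ , pu , px) = separated-yCols ys _ (units us pu)
  where
  units : ∀ us → PositivePairs us → Separated (unitColumns us ++ map xCol xs)
  units [] [] = subst Separated (++-identityʳ (map xCol xs)) (separated-xCols [] px tt tt)
  units ((p , n) ∷ us) ((pp , _) ∷ pu)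
    rewrite ++-assoc (map xCol p) ((0 , 0) ∷ map yCol n ++ unitColumns us) (map xCol xs)
          | ++-assoc (map yCol n) (unitColumns us) (map xCol xs) =
    separated-xCols _ pp refl (separated-yCols n _ (units us pu))

length-columns : ∀ st → length (columns st) ≡ size st
length-columns (state ys us xs) = begin
  length (map yCol ys ++ unitColumns us ++ map xCol xs)
    ≡⟨ length-++ (map yCol ys) ⟩
  length (map yCol ys) + length (unitColumns us ++ map xCol xs)
    ≡⟨ cong₂ _+_ (length-map yCol ys) (trans (length-++ (unitColumns us)) (cong₂ _+_ (units us) (length-map xCol xs))) ⟩
  length ys + (sum (map pairSize us) + length xs)
    ≡⟨ +-assoc (length ys) _ _ ⟨
  length ys + sum (map pairSize us) + length xs ∎
  where
  open ≡-Reasoning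
  units : ∀ us → length (unitColumns us) ≡ sum (map pairSize us)
  units [] = refl
  units ((p , n) ∷ us) = begin
    length (map xCol p ++ (0 , 0) ∷ map yCol n ++ unitColumns us)
      ≡⟨ length-++ (map xCol p) ⟩
    length (map xCol p) + suc (length (map yCol n ++ unitColumns us))
      ≡⟨ cong₂ (λ a b → a + suc b) (length-map xCol p) (trans (length-++ (map yCol n)) (cong₂ _+_ (length-map yCol n) (units us))) ⟩
    length p + suc (length n + sum (map pairSize us))
      ≡⟨ +-suc (length p) _ ⟩
    suc (length p + (length n + sum (map pairSize us)))
      ≡⟨ cong suc (+-assoc (length p) (length n) _) ⟨
    suc (length p + length n + sum (map pairSize us)) ∎

data Chain : ℕ → List ℕ → Set where
  []  : ∀ {c} → Chain c []
  _∷_ : ∀ {c v vs} → v ≤ suc c → Chain v vs → Chain c (v ∷ vs)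

ValidColumns : List Column → Set
ValidColumns cs = Chain 0 (map proj₁ cs) × Chain (suc (lastOr 0 (map proj₁ cs))) (map proj₂ cs) × Separated cs

chain-++ : ∀ {c} as {bs} → Chain c as → Chain (lastOr c as) bs → Chain c (as ++ bs)
chain-++ [] [] q = q
chain-++ (a ∷ as) (le ∷ p) q = le ∷ chain-++ as p q

chain-split : ∀ {c} as {bs} → Chain c (as ++ bs) → Chain c as × Chain (lastOr c as) bs
chain-split [] p = [] , p
chain-split (a ∷ as) (le ∷ p) with chain-split as p
... | q₁ , q₂ = le ∷ q₁ , q₂

lastOr-++ : ∀ c as bs → lastOr c (as ++ bs) ≡ lastOr (lastOr c as) bs
lastOr-++ c [] bs = refl
lastOr-++ c (a ∷ as) bs = lastOr-++ a as bs

posChain⇒chain : ∀ {c vs} → PosChain c vs → Chain c vs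
posChain⇒chain [] = []
posChain⇒chain (le ∷ l) = s≤s le ∷ posChain⇒chain l

chain⇒posChain : ∀ {c vs} → Positive vs → Chain c vs → PosChain c vs
chain⇒posChain [] [] = []
chain⇒posChain (z<s ∷ pv) (s≤s le ∷ p) = le ∷ chain⇒posChain pv p

posChain⇒positive : ∀ {c vs} → PosChain c vs → Positive vs
posChain⇒positive [] = []
posChain⇒positive (_ ∷ l) = z<s ∷ posChain⇒positive l

zeros : List ℕ → List ℕ
zeros = map (λ _ → 0)

chain-zeros : ∀ c vs → Chain c (zeros vs)
chain-zeros c [] = []
chain-zeros c (v ∷ vs) = z≤n ∷ chain-zeros 0 vs

lastOr-zeros : ∀ vs → lastOr 0 (zeros vs) ≡ 0
lastOr-zeros [] = refl
lastOr-zeros (v ∷ vs) = lastOr-zeros vs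

chain-zeros-++ : ∀ {c} vs bs → Chain 0 bs → Chain c (zeros vs ++ bs)
chain-zeros-++ [] bs p = chain-mono p
  where
  chain-mono : ∀ {c bs} → Chain 0 bs → Chain c bs
  chain-mono [] = []
  chain-mono (le ∷ p) = ≤-trans le (s≤s z≤n) ∷ p
chain-zeros-++ (v ∷ vs) bs p = z≤n ∷ chain-zeros-++ vs bs p

chain-zeros-split : ∀ {c} vs bs → Chain c (zeros vs ++ bs) → Chain (lastOr c (zeros vs)) bs
chain-zeros-split vs bs p = proj₂ (chain-split (zeros vs) p)

unitXs : List ChainPair → List ℕ
unitXs [] = []
unitXs ((p , n) ∷ us) = p ++ 0 ∷ zeros n ++ unitXs us

unitYs : List ChainPair → List ℕ
unitYs [] = []
unitYs ((p , n) ∷ us) = zeros p ++ 0 ∷ n ++ unitYs us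

map-map : ∀ {A B C : Set} (f : B → C) (g : A → B) xs → map f (map g xs) ≡ map (λ x → f (g x)) xs
map-map f g xs = sym (map-∘ xs)

xs-unitColumns : ∀ us → map proj₁ (unitColumns us) ≡ unitXs us
xs-unitColumns [] = refl
xs-unitColumns ((p , n) ∷ us) = begin
  map proj₁ (map xCol p ++ (0 , 0) ∷ map yCol n ++ unitColumns us)
    ≡⟨ map-++ proj₁ (map xCol p) _ ⟩
  map proj₁ (map xCol p) ++ 0 ∷ map proj₁ (map yCol n ++ unitColumns us)
    ≡⟨ cong₂ (λ a b → a ++ 0 ∷ b) (trans (map-map proj₁ xCol p) (map-id p))
         (trans (map-++ proj₁ (map yCol n) (unitColumns us)) (cong₂ _++_ (map-map proj₁ yCol n) (xs-unitColumns us))) ⟩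
  p ++ 0 ∷ zeros n ++ unitXs us ∎
  where open ≡-Reasoning

ys-unitColumns : ∀ us → map proj₂ (unitColumns us) ≡ unitYs us
ys-unitColumns [] = refl
ys-unitColumns ((p , n) ∷ us) = begin
  map proj₂ (map xCol p ++ (0 , 0) ∷ map yCol n ++ unitColumns us)
    ≡⟨ map-++ proj₂ (map xCol p) _ ⟩
  map proj₂ (map xCol p) ++ 0 ∷ map proj₂ (map yCol n ++ unitColumns us)
    ≡⟨ cong₂ (λ a b → a ++ 0 ∷ b) (map-map proj₂ xCol p)
         (trans (map-++ proj₂ (map yCol n) (unitColumns us))
                (cong₂ _++_ (trans (map-map proj₂ yCol n) (map-id n)) (ys-unitColumns us))) ⟩
  zeros p ++ 0 ∷ n ++ unitYs us ∎
  where open ≡-Reasoning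

xs-columns : ∀ ys us xs → map proj₁ (columns (state ys us xs)) ≡ zeros ys ++ unitXs us ++ xs
xs-columns ys us xs = trans (map-++ proj₁ (map yCol ys) _)
  (cong₂ _++_ (map-map proj₁ yCol ys)
    (trans (map-++ proj₁ (unitColumns us) _) (cong₂ _++_ (xs-unitColumns us) (trans (map-map proj₁ xCol xs) (map-id xs)))))

ys-columns : ∀ ys us xs → map proj₂ (columns (state ys us xs)) ≡ ys ++ unitYs us ++ zeros xs
ys-columns ys us xs = trans (map-++ proj₂ (map yCol ys) _)
  (cong₂ _++_ (trans (map-map proj₂ yCol ys) (map-id ys))
    (trans (map-++ proj₂ (unitColumns us) _) (cong₂ _++_ (ys-unitColumns us) (map-map proj₂ xCol xs))))

lastOr-unitXs : ∀ us → lastOr 0 (unitXs us) ≡ 0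
lastOr-unitXs [] = refl
lastOr-unitXs ((p , n) ∷ us) = begin
  lastOr 0 (p ++ 0 ∷ zeros n ++ unitXs us)    ≡⟨ lastOr-++ 0 p _ ⟩
  lastOr 0 (zeros n ++ unitXs us)             ≡⟨ lastOr-++ 0 (zeros n) _ ⟩
  lastOr (lastOr 0 (zeros n)) (unitXs us)     ≡⟨ cong (λ z → lastOr z (unitXs us)) (lastOr-zeros n) ⟩
  lastOr 0 (unitXs us)                        ≡⟨ lastOr-unitXs us ⟩
  0                                           ∎
  where open ≡-Reasoning

lastOr-xs-columns : ∀ ys us xs → lastOr 0 (map proj₁ (columns (state ys us xs))) ≡ lastOr 0 xs
lastOr-xs-columns ys us xs = begin
  lastOr 0 (map proj₁ (columns (state ys us xs)))   ≡⟨ cong (lastOr 0) (xs-columns ys us xs) ⟩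
  lastOr 0 (zeros ys ++ unitXs us ++ xs)            ≡⟨ lastOr-++ 0 (zeros ys) _ ⟩
  lastOr (lastOr 0 (zeros ys)) (unitXs us ++ xs)    ≡⟨ cong (λ z → lastOr z (unitXs us ++ xs)) (lastOr-zeros ys) ⟩
  lastOr 0 (unitXs us ++ xs)                        ≡⟨ lastOr-++ 0 (unitXs us) xs ⟩
  lastOr (lastOr 0 (unitXs us)) xs                  ≡⟨ cong (λ z → lastOr z xs) (lastOr-unitXs us) ⟩
  lastOr 0 xs                                       ∎
  where open ≡-Reasoning

chain-unitXs : ∀ us xs → All ValidPair us → PosChain 0 xs → Chain 0 (unitXs us ++ xs)
chain-unitXs [] xs [] cx = posChain⇒chain cx
chain-unitXs ((p , n) ∷ us) xs ((cp , _) ∷ v) cx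
  rewrite ++-assoc p (0 ∷ zeros n ++ unitXs us) xs | ++-assoc (zeros n) (unitXs us) xs =
  chain-++ p (posChain⇒chain cp) (z≤n ∷ chain-zeros-++ n _ (chain-unitXs us xs v cx))

chain-unitYs : ∀ c us xs → All ValidPair us → Chain c (unitYs us ++ zeros xs)
chain-unitYs c [] xs [] = chain-zeros c xs
chain-unitYs c ((p , n) ∷ us) xs ((_ , cn) ∷ v)
  rewrite ++-assoc (zeros p) (0 ∷ n ++ unitYs us) (zeros xs) | ++-assoc n (unitYs us) (zeros xs) =
  chain-zeros-++ p _ (z≤n ∷ chain-++ n (posChain⇒chain cn) (chain-unitYs _ us xs v))

positiveState : ∀ {st} → ValidState st → PositiveState st
positiveState ((cx , cy) , v) = posChain⇒positive cy , All.map positivePair v , posChain⇒positive cx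
  where
  positivePair : ∀ {u} → ValidPair u → Positive (proj₁ u) × Positive (proj₂ u)
  positivePair (cp , cn) = posChain⇒positive cp , posChain⇒positive cn

validColumns-columns : ∀ st → ValidState st → ValidColumns (columns st)
validColumns-columns st@(state ys us xs) vs@((cx , cy) , v) =
  subst (Chain 0) (sym (xs-columns ys us xs)) (chain-zeros-++ ys _ (chain-unitXs us xs v cx)) ,
  subst₂ (λ u w → Chain (suc u) w) (sym (lastOr-xs-columns ys us xs)) (sym (ys-columns ys us xs))
    (chain-++ ys (posChain⇒chain cy) (chain-unitYs _ us xs v)) ,
  separated-columns st (positiveState vs)

posChains-unitXs : ∀ us xs → PositivePairs us → Positive xs → Chain 0 (unitXs us ++ xs) →
                   All (λ u → PosChain 0 (proj₁ u)) us × PosChain 0 xs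
posChains-unitXs [] xs [] px ch = [] , chain⇒posChain px ch
posChains-unitXs ((p , n) ∷ us) xs ((pp , _) ∷ pu) px ch
  rewrite ++-assoc p (0 ∷ zeros n ++ unitXs us) xs | ++-assoc (zeros n) (unitXs us) xs
  with chain-split p ch
... | chp , _ ∷ rest with posChains-unitXs us xs pu px (subst (λ z → Chain z (unitXs us ++ xs)) (lastOr-zeros n) (chain-zeros-split n _ rest))
... | cus , cx = chain⇒posChain pp chp ∷ cus , cx

posChains-unitYs : ∀ c us xs → PositivePairs us → Chain c (unitYs us ++ zeros xs) → All (λ u → PosChain 0 (proj₂ u)) us
posChains-unitYs c [] xs [] ch = []
posChains-unitYs c ((p , n) ∷ us) xs ((_ , pn) ∷ pu) ch
  rewrite ++-assoc (zeros p) (0 ∷ n ++ unitYs us) (zeros xs) | ++-assoc n (unitYs us) (zeros xs)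
  with chain-zeros-split p _ ch
... | _ ∷ rest with chain-split n rest
... | chn , rest′ = chain⇒posChain pn chn ∷ posChains-unitYs _ us xs pu rest′

validState-columns : ∀ st → PositiveState st → ValidColumns (columns st) → ValidState st
validState-columns (state ys us xs) (py , pu , px) (chx , chy , _) =
  (cx , chain⇒posChain py (proj₁ (chain-split ys chy′))) , All.zip (cps , cns)
  where
  chx′ = subst (Chain 0) (xs-columns ys us xs) chx
  chy′ = subst₂ (λ u w → Chain (suc u) w) (lastOr-xs-columns ys us xs) (ys-columns ys us xs) chy
  xsPart = posChains-unitXs us xs pu px (subst (λ z → Chain z (unitXs us ++ xs)) (lastOr-zeros ys) (chain-zeros-split ys _ chx′))
  cps = proj₁ xsPart
  cx = proj₂ xsPart
  cns = posChains-unitYs _ us xs pu (proj₂ (chain-split ys chy′))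

-- Heights of columns

countBelow : (ℕ → Bool) → ℕ → ℕ
countBelow f zero = 0
countBelow f (suc B) = if f B then suc (countBelow f B) else countBelow f B

DownClosed : (ℕ → Bool) → Set
DownClosed f = ∀ j → T (f (suc j)) → T (f j)

downClosed-≤ : ∀ {f} → DownClosed f → ∀ {i j} → i ≤ j → T (f j) → T (f i)
downClosed-≤ dc {i} {j} i≤j fj with m≤n⇒m<n∨m≡n i≤j
... | inj₂ refl = fj
... | inj₁ i<j with j
...   | suc j′ = downClosed-≤ dc (≤-pred i<j) (dc j′ fj)

countBelow-≤ : ∀ f B → countBelow f B ≤ B
countBelow-≤ f zero = z≤n
countBelow-≤ f (suc B) with f B
... | true = s≤s (countBelow-≤ f B)
... | false = m≤n⇒m≤1+n (countBelow-≤ f B)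

countBelow-all : ∀ f B → (∀ j → j < B → T (f j)) → countBelow f B ≡ B
countBelow-all f zero _ = refl
countBelow-all f (suc B) all with f B | all B ≤-refl
... | true | _ = cong suc (countBelow-all f B (λ j j<B → all j (m≤n⇒m≤1+n j<B)))

countBelow-cong : ∀ {f g} → (∀ j → f j ≡ g j) → ∀ B → countBelow f B ≡ countBelow g B
countBelow-cong f≗g zero = refl
countBelow-cong f≗g (suc B) rewrite f≗g B | countBelow-cong f≗g B = refl

countBelow-spec : ∀ f → DownClosed f → ∀ B → (∀ j → T (f j) → j < B) →
                  ∀ j → (T (f j) → j < countBelow f B) × (j < countBelow f B → T (f j))
countBelow-spec f dc zero bound j = (λ fj → ⊥-elim (<⇒≱ (bound j fj) z≤n)) , λ ()
countBelow-spec f dc (suc B) bound j with f B in fB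
... | true = (λ fj → subst (j <_) (sym (cong suc count≡B)) (bound j fj)) ,
             (λ j<count → downClosed-≤ dc (≤-pred (subst (j <_) (cong suc count≡B) j<count)) (subst T (sym fB) tt))
  where
  count≡B : countBelow f B ≡ B
  count≡B = countBelow-all f B (λ i i<B → downClosed-≤ dc (<⇒≤ i<B) (subst T (sym fB) tt))
... | false = countBelow-spec f dc B bound′ j
  where
  bound′ : ∀ j → T (f j) → j < B
  bound′ j fj with m≤n⇒m<n∨m≡n (≤-pred (bound j fj))
  ... | inj₁ j<B = j<B
  ... | inj₂ refl = ⊥-elim (subst T fB fj)

≡-by-< : ∀ {a b} → (∀ j → j < a → j < b) → (∀ j → j < b → j < a) → a ≡ b
≡-by-< f g = ≤-antisym (≤-by-< f) (≤-by-< g)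
  where
  ≤-by-< : ∀ {a b} → (∀ j → j < a → j < b) → a ≤ b
  ≤-by-< {zero} _ = z≤n
  ≤-by-< {suc a} h = h a ≤-refl

columnsOf : (ℕ → ℕ) → ℕ → List Column
columnsOf F zero = []
columnsOf F (suc m) = (F 2 , F 1) ∷ columnsOf (λ r → F (2 + r)) m

length-columnsOf : ∀ F m → length (columnsOf F m) ≡ m
length-columnsOf F zero = refl
length-columnsOf F (suc m) = cong suc (length-columnsOf (λ r → F (2 + r)) m)

2+r≤ : ∀ {r} m → r ≤ m + m → 2 + r ≤ suc m + suc m
2+r≤ {r} m r≤ = subst (2 + r ≤_) (cong suc (sym (+-suc m m))) (s≤s (s≤s r≤))

columnsOf-cong : ∀ F G m → (∀ r → 1 ≤ r → r ≤ m + m → F r ≡ G r) → columnsOf F m ≡ columnsOf G m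
columnsOf-cong F G zero _ = refl
columnsOf-cong F G (suc m) F≗G =
  cong₂ _∷_ (cong₂ _,_ (F≗G 2 (s≤s z≤n) (2+r≤ m z≤n)) (F≗G 1 (s≤s z≤n) (≤-trans (n≤1+n 1) (2+r≤ m z≤n))))
            (columnsOf-cong (λ r → F (2 + r)) (λ r → G (2 + r)) m (λ r 1≤r r≤ → F≗G (2 + r) (≤-trans 1≤r (m≤n+m r 2)) (2+r≤ m r≤)))

heightAt : List Column → ℕ → ℕ
heightAt [] _ = 0
heightAt (_ ∷ _) zero = 0
heightAt ((x , y) ∷ cs) 1 = y
heightAt ((x , y) ∷ cs) 2 = x
heightAt (_ ∷ cs) (suc (suc (suc r))) = heightAt cs (suc r)

heightAt-x-bound : ∀ c cs i → Chain c (map proj₁ cs) → heightAt cs (suc i + suc i) ≤ c + suc i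
heightAt-x-bound c [] i _ = z≤n
heightAt-x-bound c ((x , y) ∷ cs) zero (le ∷ _) = subst (x ≤_) (+-comm 1 c) le
heightAt-x-bound c ((x , y) ∷ cs) (suc i) (le ∷ ch) rewrite +-suc i (suc i) =
  ≤-trans (heightAt-x-bound x cs i ch) (subst (x + suc i ≤_) (sym (+-suc c (suc i))) (+-monoˡ-≤ (suc i) le))

heightAt-y-bound : ∀ c cs i → Chain c (map proj₂ cs) → heightAt cs (suc (i + i)) ≤ c + suc i
heightAt-y-bound c [] i _ = z≤n
heightAt-y-bound c ((x , y) ∷ cs) zero (le ∷ _) = subst (y ≤_) (+-comm 1 c) le
heightAt-y-bound c ((x , y) ∷ cs) (suc i) (le ∷ ch) rewrite +-suc i i =
  ≤-trans (heightAt-y-bound y cs i ch) (subst (y + suc i ≤_) (sym (+-suc c (suc i))) (+-monoˡ-≤ (suc i) le))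

lastOr-≤ : ∀ c vs → Chain c vs → lastOr c vs ≤ c + length vs
lastOr-≤ c [] _ = m≤m+n c 0
lastOr-≤ c (v ∷ vs) (le ∷ ch) = ≤-trans (lastOr-≤ v vs ch) (subst (v + length vs ≤_) (sym (+-suc c (length vs))) (+-monoˡ-≤ (length vs) le))

heightAt-2 : ∀ cs → Chain 0 (map proj₁ cs) → heightAt cs 2 ≤ 1
heightAt-2 [] _ = z≤n
heightAt-2 ((x , y) ∷ cs) (le ∷ _) = le

heightAt-+2 : ∀ {a b} cs r → Chain a (map proj₁ cs) → Chain b (map proj₂ cs) →
              heightAt cs (2 + suc r) ≤ suc (heightAt cs (suc r))
heightAt-+2 [] r _ _ = z≤n
heightAt-+2 (_ ∷ []) zero _ _ = z≤n
heightAt-+2 (_ ∷ _ ∷ _) zero _ (_ ∷ le ∷ _) = le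
heightAt-+2 (_ ∷ []) (suc zero) _ _ = z≤n
heightAt-+2 (_ ∷ _ ∷ _) (suc zero) (_ ∷ le ∷ _) _ = le
heightAt-+2 (_ ∷ cs) (suc (suc r)) (_ ∷ chx) (_ ∷ chy) = heightAt-+2 cs r chx chy

heightAt-last : ∀ cs → 0 < length cs → heightAt cs (length cs + length cs) ≡ lastOr 0 (map proj₁ cs)
heightAt-last ((x , y) ∷ []) _ = refl
heightAt-last ((x , y) ∷ c ∷ cs) _ =
  trans (cong (λ z → heightAt ((x , y) ∷ c ∷ cs) (suc (suc z))) (+-suc (length cs) (suc (length cs))))
        (heightAt-last (c ∷ cs) (s≤s z≤n))

heightAt-separated : ∀ cs r → Separated cs → 0 < heightAt cs (suc r) → 0 < heightAt cs (suc (suc r)) → ⊥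
heightAt-separated [] r _ ()
heightAt-separated ((zero , y) ∷ cs) zero _ _ ()
heightAt-separated ((suc x , y) ∷ cs) zero (refl , _ , _) () _
heightAt-separated ((zero , y) ∷ cs) (suc zero) _ () _
heightAt-separated ((suc x , y) ∷ []) (suc zero) _ _ ()
heightAt-separated ((suc x , y) ∷ (x′ , .0) ∷ cs) (suc zero) (_ , refl , _) _ ()
heightAt-separated ((zero , y) ∷ cs) (suc (suc r)) sep = heightAt-separated cs r sep
heightAt-separated ((suc x , y) ∷ cs) (suc (suc r)) (_ , _ , sep) = heightAt-separated cs r sep


heightAt-columnsOf : ∀ F m r → 1 ≤ r → r ≤ m + m → heightAt (columnsOf F m) r ≡ F r
heightAt-columnsOf F zero (suc r) _ ()
heightAt-columnsOf F (suc m) 1 _ _ = refl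
heightAt-columnsOf F (suc m) 2 _ _ = refl
heightAt-columnsOf F (suc m) (suc (suc (suc r))) _ r≤ =
  heightAt-columnsOf (λ r → F (2 + r)) m (suc r) (s≤s z≤n) (≤-pred (≤-pred (subst (3 + r ≤_) (cong suc (+-suc m m)) r≤)))

columnsOf-heightAt : ∀ cs → columnsOf (heightAt cs) (length cs) ≡ cs
columnsOf-heightAt [] = refl
columnsOf-heightAt (c ∷ cs) = cong (c ∷_)
  (trans (columnsOf-cong (λ r → heightAt (c ∷ cs) (2 + r)) (heightAt cs) (length cs) shifted) (columnsOf-heightAt cs))
  where
  shifted : ∀ r → 1 ≤ r → r ≤ length cs + length cs → heightAt (c ∷ cs) (2 + r) ≡ heightAt cs r
  shifted (suc r) _ _ = refl

lastOr-columnsOf : ∀ F m → lastOr 0 (map proj₁ (columnsOf F (suc m))) ≡ F (suc m + suc m)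
lastOr-columnsOf F zero = refl
lastOr-columnsOf F (suc m) =
  trans (lastOr-columnsOf (λ r → F (2 + r)) m) (cong (λ z → F (2 + z)) (sym (+-suc m (suc m))))

StepBound : (ℕ → ℕ) → ℕ → Set
StepBound F m = ∀ r → 2 + suc r ≤ m + m → F (2 + suc r) ≤ suc (F (suc r))

stepBound-shift : ∀ F m → StepBound F (suc m) → StepBound (λ r → F (2 + r)) m
stepBound-shift F m step r r≤ = step (2 + r) (2+r≤ m r≤)

chain-x-columnsOf : ∀ F m c → (0 < m → F 2 ≤ suc c) → StepBound F m → Chain c (map proj₁ (columnsOf F m))
chain-x-columnsOf F zero c _ _ = []
chain-x-columnsOf F (suc zero) c first _ = first z<s ∷ []
chain-x-columnsOf F (suc (suc m)) c first step =
  first z<s ∷ chain-x-columnsOf (λ r → F (2 + r)) (suc m) (F 2) (λ _ → step 1 (2+r≤ (suc m) (2+r≤ m z≤n))) (stepBound-shift F (suc m) step)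

chain-y-columnsOf : ∀ F m c → (0 < m → F 1 ≤ suc c) → StepBound F m → Chain c (map proj₂ (columnsOf F m))
chain-y-columnsOf F zero c _ _ = []
chain-y-columnsOf F (suc zero) c first _ = first z<s ∷ []
chain-y-columnsOf F (suc (suc m)) c first step =
  first z<s ∷ chain-y-columnsOf (λ r → F (2 + r)) (suc m) (F 1)
                (λ _ → step 0 (≤-trans (n≤1+n 3) (2+r≤ (suc m) (2+r≤ m z≤n)))) (stepBound-shift F (suc m) step)

NoAdjacentPositive : (ℕ → ℕ) → ℕ → Set
NoAdjacentPositive F m = ∀ r → suc r < m + m → 0 < F (suc r) → 0 < F (2 + r) → ⊥

separated-columnsOf : ∀ F m → NoAdjacentPositive F m → Separated (columnsOf F m)
separated-columnsOf F zero _ = tt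
separated-columnsOf F (suc m) noAdj with F 2 in F2≡
... | zero = separated-columnsOf (λ r → F (2 + r)) m noAdj′
  where
  noAdj′ : NoAdjacentPositive (λ r → F (2 + r)) m
  noAdj′ r r< = noAdj (2 + r) (2+r≤ m r<)
... | suc x = F1≡0 , nextY≡0 m noAdj , separated-columnsOf (λ r → F (2 + r)) m (λ r r< → noAdj (2 + r) (2+r≤ m r<))
  where
  F2>0 : 0 < F 2
  F2>0 = subst (0 <_) (sym F2≡) z<s
  F1≡0 : F 1 ≡ 0
  F1≡0 = n≤0⇒n≡0 (≮⇒≥ λ F1>0 → noAdj 0 (2+r≤ m z≤n) F1>0 F2>0)
  nextY≡0 : ∀ m → NoAdjacentPositive F (suc m) → HeadY≡0 (columnsOf (λ r → F (2 + r)) m)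
  nextY≡0 zero _ = tt
  nextY≡0 (suc m) noAdj = n≤0⇒n≡0 (≮⇒≥ λ F3>0 → noAdj 1 (2+r≤ (suc m) (s≤s z≤n)) F2>0 F3>0)

-- From columns to paths

strictInverse : ∀ {S T : Setoid 0ℓ 0ℓ} (to : Setoid.Carrier S → Setoid.Carrier T) (from : Setoid.Carrier T → Setoid.Carrier S) →
                Congruent (Setoid._≈_ S) (Setoid._≈_ T) to → Congruent (Setoid._≈_ T) (Setoid._≈_ S) from →
                StrictlyInverseˡ (Setoid._≈_ T) to from → StrictlyInverseʳ (Setoid._≈_ S) to from → Inverse S T
strictInverse {S} {T} to from to-cong from-cong invˡ invʳ = record
  { to = to ; from = from ; to-cong = to-cong ; from-cong = from-cong
  ; inverse = strictlyInverseˡ⇒inverseˡ to-cong invˡ , strictlyInverseʳ⇒inverseʳ from-cong invʳ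
  }
  where open Consequences S T

toVec : ∀ {A : Set} {n} (xs : List A) → length xs ≡ n → Vec A n
toVec xs eq = Vec.cast eq (Vec.fromList xs)

toList-toVec : ∀ {A : Set} {n} (xs : List A) (eq : length xs ≡ n) → toList (toVec xs eq) ≡ xs
toList-toVec xs eq = trans (toList-cast eq (Vec.fromList xs)) (toList∘fromList xs)

toList-injective′ : ∀ {A : Set} {n} (u v : Vec A n) → toList u ≡ toList v → u ≡ v
toList-injective′ u v eq = trans (sym (cast-is-id refl u)) (toList-injective refl u v eq)

height≡endLevel : ∀ {n} (v : Vec Step n) → height v ≡ endLevel 0ℤ (toList v)
height≡endLevel Vec.[] = refl
height≡endLevel (up Vec.∷ v) = trans (cong ℤ.suc (height≡endLevel v)) (sym (endLevel-suc 0ℤ (toList v)))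
height≡endLevel (down Vec.∷ v) = trans (cong ℤ.pred (height≡endLevel v)) (sym (endLevel-pred 0ℤ (toList v)))

ListPath : ℕ → Set
ListPath n = Σ (List Step) (λ q → length q ≡ n × 0ℤ ℤ.< endLevel 0ℤ q)

listPathSetoid : ℕ → Setoid 0ℓ 0ℓ
listPathSetoid n = On.setoid (setoid (List Step)) (proj₁ {B = λ q → length q ≡ n × 0ℤ ℤ.< endLevel 0ℤ q})

lists↔vectors : ∀ n → Inverse (listPathSetoid n) (PathSetoid n)
lists↔vectors n = strictInverse toVector fromVector
  (λ {p} {q} p≡q → toList-injective′ _ _ (trans (toList-toVec _ (proj₁ (proj₂ p))) (trans p≡q (sym (toList-toVec _ (proj₁ (proj₂ q)))))))
  (cong toList)
  (λ (v , _) → toList-injective′ _ v (toList-toVec (toList v) (length-toList v)))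
  (λ (q , len , _) → toList-toVec q len)
  where
  toVector : ListPath n → Setoid.Carrier (PathSetoid n)
  toVector (q , len , positive) =
    toVec q len , subst (0ℤ ℤ.<_) (sym (trans (height≡endLevel (toVec q len)) (cong (endLevel 0ℤ) (toList-toVec q len)))) positive
  fromVector : Setoid.Carrier (PathSetoid n) → ListPath n
  fromVector (v , positive) = toList v , length-toList v , subst (0ℤ ℤ.<_) (height≡endLevel v) positive

pathOfColumns : List Column → List Step
pathOfColumns cs = encodePath (decodeColumns cs)

columnsOfPath : List Step → List Column
columnsOfPath q = columns (decodePath q)

module _ {cs : List Column} (valid : ValidColumns cs) where

  private
    separated = proj₂ (proj₂ valid)
    st = decodeColumns cs

  validState-decodeColumns : ValidState st
  validState-decodeColumns =
    validState-columns st (positive-decodeColumns cs) (subst ValidColumns (sym (columns-decodeColumns cs separated)) valid)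

  length-pathOfColumns : length (pathOfColumns cs) ≡ suc (length cs + length cs)
  length-pathOfColumns = trans (length-encodePath validState-decodeColumns)
    (cong (λ n → suc (n + n)) (trans (sym (length-columns st)) (cong length (columns-decodeColumns cs separated))))

  endLevel-pathOfColumns : ∃ λ e → endLevel 0ℤ (pathOfColumns cs) ≡ ℤ.+ suc e
  endLevel-pathOfColumns = endLevel-encodePath validState-decodeColumns

  columnsOfPath-pathOfColumns : columnsOfPath (pathOfColumns cs) ≡ cs
  columnsOfPath-pathOfColumns = trans (cong columns (decodePath-encodePath validState-decodeColumns)) (columns-decodeColumns cs separated)

module _ (q : List Step) (k : ℕ) (len : length q ≡ suc (k + k)) (nonNeg : 0ℤ ℤ.≤ endLevel 0ℤ q) where

  private
    st = decodePath q
    decoded = encodePath-decodePath q k len nonNeg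
    vst = proj₂ decoded

  pathOfColumns-columnsOfPath : pathOfColumns (columnsOfPath q) ≡ q
  pathOfColumns-columnsOfPath = trans (cong encodePath (decodeColumns-columns st (positiveState vst))) (proj₁ decoded)

  validColumns-columnsOfPath : ValidColumns (columnsOfPath q)
  validColumns-columnsOfPath = validColumns-columns st vst

  length-columnsOfPath : length (columnsOfPath q) ≡ k
  length-columnsOfPath = trans (length-columns st)
    (≤-antisym (double-≤ (≤-reflexive size+size≡)) (double-≤ (≤-reflexive (sym size+size≡))))
    where
    size+size≡ : size st + size st ≡ k + k
    size+size≡ = suc-injective (trans (sym (length-encodePath vst)) (trans (cong length (proj₁ decoded)) len))

-- Ideals of P_{s,s+2}

module Gaps (k : ℕ) where

  s : ℕ
  s = suc (k + k)

  t : ℕ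
  t = s + 2

  instance
    s-nonZero : NonZero s
    s-nonZero = _

  divMod-unique : ∀ r j → r < s → ((r + j * s) % s ≡ r) × ((r + j * s) / s ≡ j)
  divMod-unique r j r<s =
    trans ([m+kn]%n≡m%n r j s) (m<n⇒m%n≡m r<s) ,
    trans (+-distrib-/-∣ʳ r (divides j refl)) (cong₂ _+_ (m<n⇒m/n≡0 r<s) (m*n/n≡m j s))

  divMod : ∀ n → n ≡ n % s + (n / s) * s
  divMod n = m≡m%n+[m/n]*n n s

  representable-form : ∀ a b → a * s + b * t ≡ (a + b) * s + (b + b)
  representable-form a b = shuffle a b s
    where
    shuffle : ∀ a b s → a * s + b * (s + 2) ≡ (a + b) * s + (b + b)
    shuffle = solve-∀

  division-cases : ∀ r j m b → r < s → r + j * s ≡ m * s + (b + b) → (j ≡ m × r ≡ b + b) ⊎ (r + s ≤ b + b × m < j)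
  division-cases r j m b r<s e with ≤-<-connex j m
  ... | inj₁ j≤m = inj₁ (j≡m , r≡2b)
    where
    d = m ∸ j
    m≡j+d : m ≡ j + d
    m≡j+d = sym (m+[n∸m]≡n j≤m)
    shuffle : ∀ j d s x → (j + d) * s + x ≡ j * s + (d * s + x)
    shuffle = solve-∀
    r≡ : r ≡ d * s + (b + b)
    r≡ = +-cancelˡ-≡ (j * s) _ _ (trans (+-comm (j * s) r) (trans e (trans (cong (λ z → z * s + (b + b)) m≡j+d) (shuffle j d s (b + b)))))
    d≡0 : d ≡ 0
    d≡0 with d | r≡
    ... | zero | _ = refl
    ... | suc d′ | r≡′ = ⊥-elim (<⇒≱ r<s (subst (s ≤_) (sym r≡′) (≤-trans (m≤m+n s (d′ * s)) (m≤m+n _ (b + b)))))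
    j≡m : j ≡ m
    j≡m = sym (trans m≡j+d (trans (cong (j +_) d≡0) (+-identityʳ j)))
    r≡2b : r ≡ b + b
    r≡2b = trans r≡ (cong (λ z → z * s + (b + b)) d≡0)
  ... | inj₂ m<j = inj₂ (subst (r + s ≤_) (+-cancelˡ-≡ (m * s) _ _ e′) (m≤m+n (r + s) (d * s)) , m<j)
    where
    d = j ∸ suc m
    shuffle : ∀ m r s d → m * s + (r + s + d * s) ≡ r + (suc m + d) * s
    shuffle = solve-∀
    e′ : m * s + (r + s + d * s) ≡ m * s + (b + b)
    e′ = trans (shuffle m r s d) (trans (cong (λ z → r + z * s) (m+[n∸m]≡n m<j)) e)

  gap-even : ∀ i j → i + i < s → j < i → InP s t (i + i + j * s)
  gap-even i j 2i<s j<i (a , b , e) with division-cases (i + i) j (a + b) b 2i<s (trans e (representable-form a b))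
  ... | inj₁ (j≡m , 2i≡2b) =
    <⇒≱ j<i (≤-trans (double-≤ (≤-reflexive 2i≡2b)) (subst (b ≤_) (sym j≡m) (m≤n+m b a)))
  ... | inj₂ (2i+s≤2b , m<j) =
    <⇒≱ j<i (≤-trans (double-≤ (≤-trans (m≤m+n (i + i) s) 2i+s≤2b)) (≤-trans (m≤n+m b a) (<⇒≤ m<j)))

  gap-odd : ∀ i j → suc (i + i) < s → j < i + k + 2 → InP s t (suc (i + i) + j * s)
  gap-odd i j 2i+1<s j< (a , b , e) with division-cases (suc (i + i)) j (a + b) b 2i+1<s (trans e (representable-form a b))
  ... | inj₁ (_ , 2i+1≡2b) =
    even≢odd b i (trans (cong (b +_) (+-identityʳ b)) (trans (sym 2i+1≡2b) (cong (λ z → suc (i + z)) (sym (+-identityʳ i)))))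
  ... | inj₂ (ineq , m<j) =
    <⇒≱ j< (≤-trans (≤-reflexive (shuffle₂ i k))
            (≤-trans (s≤s (double-≤ (subst (_≤ b + b) (shuffle₁ i k) ineq))) (≤-trans (s≤s (m≤n+m b a)) m<j)))
    where
    shuffle₁ : ∀ i k → suc (i + i) + suc (k + k) ≡ (i + k + 1) + (i + k + 1)
    shuffle₁ = solve-∀
    shuffle₂ : ∀ i k → i + k + 2 ≡ suc (i + k + 1)
    shuffle₂ = solve-∀

  multiple-not-gap : ∀ j → ¬ InP s t (j * s)
  multiple-not-gap j gap = gap (j , 0 , sym (+-identityʳ (j * s)))

  large-not-gap : ∀ r j → 1 ≤ r → r < s → s ≤ j → ¬ InP s t (r + j * s)
  large-not-gap r j 1≤r r<s s≤j gap with even-or-odd r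
  ... | inj₁ (zero , refl) = <⇒≱ 1≤r z≤n
  ... | inj₁ (suc i , refl) = gap (j ∸ suc i , suc i , (begin
    (suc i + suc i) + j * s                          ≡⟨ cong (λ z → (suc i + suc i) + z * s) (m+[n∸m]≡n i<j) ⟨
    (suc i + suc i) + (suc i + (j ∸ suc i)) * s      ≡⟨ shuffle i (j ∸ suc i) s ⟩
    (j ∸ suc i) * s + suc i * t                      ∎))
    where
    open ≡-Reasoning
    i<j : suc i ≤ j
    i<j = ≤-trans (m≤m+n (suc i) (suc i)) (≤-trans (<⇒≤ r<s) s≤j)
    shuffle : ∀ i d s → (suc i + suc i) + (suc i + d) * s ≡ d * s + suc i * (s + 2)
    shuffle = solve-∀
  ... | inj₂ (i , refl) = gap (j ∸ (i + k + 2) , i + k + 1 , (begin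
    suc (i + i) + j * s                                   ≡⟨ cong (λ z → suc (i + i) + z * s) (m+[n∸m]≡n ik2≤j) ⟨
    suc (i + i) + ((i + k + 2) + (j ∸ (i + k + 2))) * s   ≡⟨ shuffle i k (j ∸ (i + k + 2)) ⟩
    (j ∸ (i + k + 2)) * s + (i + k + 1) * t               ∎))
    where
    open ≡-Reasoning
    i<k : suc i ≤ k
    i<k = ≰⇒> (λ k≤i → <⇒≱ (≤-pred r<s) (+-mono-≤ k≤i k≤i))
    ik2≤j : i + k + 2 ≤ j
    ik2≤j = ≤-trans (subst₂ _≤_ (shuffle₁ i k) (shuffle₂ k) (+-monoˡ-≤ (k + 1) i<k)) s≤j
      where
      shuffle₁ : ∀ i k → suc i + (k + 1) ≡ i + k + 2
      shuffle₁ = solve-∀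
      shuffle₂ : ∀ k → k + (k + 1) ≡ suc (k + k)
      shuffle₂ = solve-∀
    shuffle : ∀ i k d → suc (i + i) + ((i + k + 2) + d) * suc (k + k) ≡ d * suc (k + k) + (i + k + 1) * (suc (k + k) + 2)
    shuffle = solve-∀

  idealOf : List Column → ℕ → Bool
  idealOf cs n = n / s <ᵇ heightAt cs (n % s)

  by-residue : (P : ℕ → Set) → (∀ r j → r < s → P (r + j * s)) → ∀ n → P n
  by-residue P f n = subst P (sym (divMod n)) (f (n % s) (n / s) (m%n<n n s))

  idealOf-canonical : ∀ cs r j → r < s → idealOf cs (r + j * s) ≡ (j <ᵇ heightAt cs r)
  idealOf-canonical cs r j r<s =
    cong₂ (λ a b → a <ᵇ heightAt cs b) (proj₂ (divMod-unique r j r<s)) (proj₁ (divMod-unique r j r<s))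

  ∈⇒< : ∀ cs r j → r < s → T (idealOf cs (r + j * s)) → j < heightAt cs r
  ∈⇒< cs r j r<s ∈ = <ᵇ⇒< j (heightAt cs r) (subst T (idealOf-canonical cs r j r<s) ∈)

  <⇒∈ : ∀ cs r j → r < s → j < heightAt cs r → T (idealOf cs (r + j * s))
  <⇒∈ cs r j r<s j< = subst T (sym (idealOf-canonical cs r j r<s)) (<⇒<ᵇ j<)

  ∉-residue0 : ∀ cs j → ¬ T (idealOf cs (0 + j * s))
  ∉-residue0 cs j ∈ with ∈⇒< cs 0 j (s≤s z≤n) ∈
  ∉-residue0 [] j ∈ | ()
  ∉-residue0 (_ ∷ _) j ∈ | ()

  heightAt-1 : ∀ cs → length cs ≡ k → Chain (suc (lastOr 0 (map proj₁ cs))) (map proj₂ cs) →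
               heightAt cs 1 ≤ 2 + heightAt cs (k + k)
  heightAt-1 [] _ _ = z≤n
  heightAt-1 ((x , y) ∷ cs) refl (le ∷ _) rewrite heightAt-last ((x , y) ∷ cs) (s≤s z≤n) = le

  heightAt-1-down : ∀ cs → length cs ≡ k → Chain (suc (lastOr 0 (map proj₁ cs))) (map proj₂ cs) →
                    ∀ j → T (idealOf cs (1 + suc (suc j) * s)) → T (idealOf cs (k + k + j * s))
  heightAt-1-down [] _ _ j ()
  heightAt-1-down cs@(_ ∷ _) len chy j ∈ =
    <⇒∈ cs (k + k) j (n<1+n _) (≤-pred (≤-pred (≤-trans (∈⇒< cs 1 (suc (suc j)) 1<s ∈) (heightAt-1 cs len chy))))
    where
    1<s : 1 < s
    1<s = s≤s (≤-trans (subst (1 ≤_) len (s≤s z≤n)) (m≤m+n k k))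

  module _ (cs : List Column) (len : length cs ≡ k) (valid : ValidColumns cs) where

    private
      chainX = proj₁ valid
      chainY = proj₁ (proj₂ valid)
      separated = proj₂ (proj₂ valid)

    heightAt-even-bound : ∀ i → heightAt cs (suc i + suc i) ≤ suc i
    heightAt-even-bound i = heightAt-x-bound 0 cs i chainX

    heightAt-odd-bound : ∀ i → heightAt cs (suc (i + i)) ≤ i + k + 2
    heightAt-odd-bound i = ≤-trans (heightAt-y-bound _ cs i chainY) (≤-trans (+-monoˡ-≤ (suc i) (s≤s lastX≤k)) (≤-reflexive (shuffle k i)))
      where
      lastX≤k : lastOr 0 (map proj₁ cs) ≤ k
      lastX≤k = ≤-trans (lastOr-≤ 0 (map proj₁ cs) chainX) (≤-reflexive (trans (length-map proj₁ cs) len))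
      shuffle : ∀ k i → suc k + suc i ≡ i + k + 2
      shuffle = solve-∀

    idealOf-gaps : ∀ n → T (idealOf cs n) → InP s t n
    idealOf-gaps = by-residue (λ n → T (idealOf cs n) → InP s t n) gaps
      where
      gaps : ∀ r j → r < s → T (idealOf cs (r + j * s)) → InP s t (r + j * s)
      gaps r j r<s ∈ with even-or-odd r
      ... | inj₁ (zero , refl) = ⊥-elim (∉-residue0 cs j ∈)
      ... | inj₁ (suc i , refl) = gap-even (suc i) j r<s (≤-trans (∈⇒< cs r j r<s ∈) (heightAt-even-bound i))
      ... | inj₂ (i , refl) = gap-odd i j r<s (≤-trans (∈⇒< cs r j r<s ∈) (heightAt-odd-bound i))

    idealOf-down-s : ∀ x → T (idealOf cs (x + s)) → T (idealOf cs x)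
    idealOf-down-s = by-residue (λ x → T (idealOf cs (x + s)) → T (idealOf cs x)) below
      where
      below : ∀ r j → r < s → T (idealOf cs (r + j * s + s)) → T (idealOf cs (r + j * s))
      below r j r<s ∈ = <⇒∈ cs r j r<s (<-trans (n<1+n j) (∈⇒< cs r (suc j) r<s (subst (T ∘′ idealOf cs) (shuffle r j s) ∈)))
        where
        shuffle : ∀ r j s → r + j * s + s ≡ r + suc j * s
        shuffle = solve-∀

    idealOf-down-t : ∀ x → T (idealOf cs (x + t)) → T (idealOf cs x)
    idealOf-down-t = by-residue (λ x → T (idealOf cs (x + t)) → T (idealOf cs x)) below
      where
      shuffle₁ : ∀ r j s → r + j * s + (s + 2) ≡ suc (suc r) + suc j * s
      shuffle₁ = solve-∀
      shuffle₂ : ∀ r j s → r + j * s + (s + 2) ≡ suc (suc r) + j * s + s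
      shuffle₂ = solve-∀
      shuffle₃ : ∀ j s → s + j * s + s ≡ 0 + suc (suc j) * s
      shuffle₃ = solve-∀
      shuffle₄ : ∀ k j → k + k + j * suc (k + k) + (suc (k + k) + 2) ≡ 1 + suc (suc j) * suc (k + k)
      shuffle₄ = solve-∀
      inner : ∀ r j → suc (suc r) < s → T (idealOf cs (suc (suc r) + suc j * s)) → T (idealOf cs (r + j * s))
      inner zero j r+2<s ∈ = ⊥-elim (<⇒≱ (∈⇒< cs 2 (suc j) r+2<s ∈) (≤-trans (heightAt-2 cs chainX) (s≤s z≤n)))
      inner (suc r) j r+2<s ∈ =
        <⇒∈ cs (suc r) j (<-trans (n<1+n _) (<-trans (n<1+n _) r+2<s))
          (≤-pred (≤-trans (∈⇒< cs (2 + suc r) (suc j) r+2<s ∈) (heightAt-+2 cs r chainX chainY)))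
      below : ∀ r j → r < s → T (idealOf cs (r + j * s + t)) → T (idealOf cs (r + j * s))
      below r j r<s ∈ with suc (suc r) <? s
      ... | yes r+2<s = inner r j r+2<s (subst (T ∘′ idealOf cs) (shuffle₁ r j s) ∈)
      ... | no r+2≮s with m≤n⇒m<n∨m≡n r<s
      ...   | inj₁ r+1<s = ⊥-elim (∉-residue0 cs (suc (suc j))
                             (subst (T ∘′ idealOf cs) (trans (shuffle₂ r j s) (trans (cong (λ z → z + j * s + s) r+2≡s) (shuffle₃ j s))) ∈))
        where
        r+2≡s : suc (suc r) ≡ s
        r+2≡s = ≤-antisym r+1<s (≮⇒≥ r+2≮s)
      ...   | inj₂ r+1≡s rewrite suc-injective r+1≡s =
        heightAt-1-down cs len chainY j (subst (T ∘′ idealOf cs) (shuffle₄ k j) ∈)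

    idealOf-noConsecutive : NoConsecutive (idealOf cs)
    idealOf-noConsecutive = by-residue (λ n → T (idealOf cs n) → T (idealOf cs (suc n)) → ⊥) noCons
      where
      noCons : ∀ r j → r < s → T (idealOf cs (r + j * s)) → T (idealOf cs (suc (r + j * s))) → ⊥
      noCons zero j _ ∈ _ = ∉-residue0 cs j ∈
      noCons (suc r) j r<s ∈ ∈′ with suc (suc r) <? s
      ... | yes r+1<s = heightAt-separated cs r separated (≤-trans (s≤s z≤n) (∈⇒< cs (suc r) j r<s ∈))
                                                         (≤-trans (s≤s z≤n) (∈⇒< cs (suc (suc r)) j r+1<s ∈′))
      ... | no r+1≮s = ∉-residue0 cs (suc j) (subst (T ∘′ idealOf cs) (trans (cong (_+ j * s) r+1≡s) (sym (+-identityˡ _))) ∈′)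
        where
        r+1≡s : suc (suc r) ≡ s
        r+1≡s = ≤-antisym r<s (≮⇒≥ r+1≮s)

    idealOf-isOrderIdeal : IsOrderIdeal s (s + 2) (idealOf cs)
    idealOf-isOrderIdeal = idealOf-gaps , downward
      where
      downward : ∀ x y → x ≤[ s , s + 2 ] y → T (idealOf cs y) → T (idealOf cs x)
      downward x .x ε ∈ = ∈
      downward x y ((_ , _ , inj₁ refl) ◅ rest) ∈ = idealOf-down-s x (downward _ y rest ∈)
      downward x y ((_ , _ , inj₂ refl) ◅ rest) ∈ = idealOf-down-t x (downward _ y rest ∈)

  Bool-ext : ∀ {a b} → (T a → T b) → (T b → T a) → a ≡ b
  Bool-ext {false} {false} _ _ = refl
  Bool-ext {false} {true} _ g = ⊥-elim (g _)
  Bool-ext {true} {false} f _ = ⊥-elim (f _)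
  Bool-ext {true} {true} _ _ = refl

  heightsOf : (ℕ → Bool) → ℕ → ℕ
  heightsOf I r = countBelow (λ j → I (r + j * s)) s

  columnsOfIdeal : (ℕ → Bool) → List Column
  columnsOfIdeal I = columnsOf (heightsOf I) k

  module _ (I : ℕ → Bool) (ideal : IsOrderIdeal s (s + 2) I) (noConsecutive : NoConsecutive I) where

    private
      gap : ∀ n → T (I n) → InP s t n
      gap = proj₁ ideal

    down-s : ∀ x → T (I (x + s)) → T (I x)
    down-s x ∈ = proj₂ ideal x (x + s) ((gap (x + s) ∈ , x-gap , inj₁ refl) ◅ ε) ∈
      where
      shuffle : ∀ a b s → a * s + b * (s + 2) + s ≡ suc a * s + b * (s + 2)
      shuffle = solve-∀
      x-gap : InP s t x
      x-gap (a , b , e) = gap (x + s) ∈ (suc a , b , trans (cong (_+ s) e) (shuffle a b s))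

    down-t : ∀ x → T (I (x + t)) → T (I x)
    down-t x ∈ = proj₂ ideal x (x + t) ((gap (x + t) ∈ , x-gap , inj₂ refl) ◅ ε) ∈
      where
      shuffle : ∀ a b s → a * s + b * (s + 2) + (s + 2) ≡ a * s + suc b * (s + 2)
      shuffle = solve-∀
      x-gap : InP s t x
      x-gap (a , b , e) = gap (x + t) ∈ (a , suc b , trans (cong (_+ t) e) (shuffle a b s))

    ∉-multiple : ∀ j → ¬ T (I (0 + j * s))
    ∉-multiple j ∈ = multiple-not-gap j (gap _ ∈)

    heightsOf-spec : ∀ r j → 1 ≤ r → r < s → (T (I (r + j * s)) → j < heightsOf I r) × (j < heightsOf I r → T (I (r + j * s)))
    heightsOf-spec r j 1≤r r<s = countBelow-spec (λ j → I (r + j * s)) downClosed s bound j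
      where
      shuffle : ∀ r j s → r + suc j * s ≡ r + j * s + s
      shuffle = solve-∀
      downClosed : DownClosed (λ j → I (r + j * s))
      downClosed j ∈ = down-s (r + j * s) (subst (T ∘′ I) (shuffle r j s) ∈)
      bound : ∀ j → T (I (r + j * s)) → j < s
      bound j ∈ = ≰⇒> (λ s≤j → large-not-gap r j 1≤r r<s s≤j (gap _ ∈))

    ∈⇒<heightsOf : ∀ r j → 1 ≤ r → r < s → T (I (r + j * s)) → j < heightsOf I r
    ∈⇒<heightsOf r j 1≤r r<s = proj₁ (heightsOf-spec r j 1≤r r<s)

    <heightsOf⇒∈ : ∀ r j → 1 ≤ r → r < s → j < heightsOf I r → T (I (r + j * s))
    <heightsOf⇒∈ r j 1≤r r<s = proj₂ (heightsOf-spec r j 1≤r r<s)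

    heightsOf-2 : 2 < s → heightsOf I 2 ≤ 1
    heightsOf-2 2<s = ≮⇒≥ λ 1<h → ∉-multiple 0 (down-t 0 (subst (T ∘′ I) (shuffle s) (<heightsOf⇒∈ 2 1 (s≤s z≤n) 2<s 1<h)))
      where
      shuffle : ∀ s → 2 + 1 * s ≡ 0 + (s + 2)
      shuffle = solve-∀

    heightsOf-step : StepBound (heightsOf I) k
    heightsOf-step r r+3≤2k = ≮⇒≥ λ h+1<h′ →
      <-irrefl refl (∈⇒<heightsOf (suc r) h z<s r+1<s (down-t _ (subst (T ∘′ I) (shuffle r h s)
        (<heightsOf⇒∈ (2 + suc r) (suc h) z<s r+3<s h+1<h′))))
      where
      h = heightsOf I (suc r)
      r+3<s : 2 + suc r < s
      r+3<s = s≤s r+3≤2k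
      r+1<s : suc r < s
      r+1<s = ≤-trans (s≤s (m≤n+m (suc r) 2)) r+3<s
      shuffle : ∀ r h s → 2 + suc r + suc h * s ≡ suc r + h * s + (s + 2)
      shuffle = solve-∀

    heightsOf-1 : 0 < k → heightsOf I 1 ≤ 2 + heightsOf I (k + k)
    heightsOf-1 0<k = ≮⇒≥ λ h+2<h′ →
      <-irrefl refl (∈⇒<heightsOf (k + k) h 1≤2k (n<1+n _) (down-t _ (subst (T ∘′ I) (shuffle k h)
        (<heightsOf⇒∈ 1 (suc (suc h)) ≤-refl (s≤s 1≤2k) h+2<h′))))
      where
      h = heightsOf I (k + k)
      1≤2k : 1 ≤ k + k
      1≤2k = ≤-trans 0<k (m≤m+n k k)
      shuffle : ∀ k h → 1 + suc (suc h) * suc (k + k) ≡ k + k + h * suc (k + k) + (suc (k + k) + 2)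
      shuffle = solve-∀

    heightsOf-noAdjacent : NoAdjacentPositive (heightsOf I) k
    heightsOf-noAdjacent r r+1<2k h>0 h′>0 =
      noConsecutive (suc r) (subst (T ∘′ I) (+-identityʳ _) (<heightsOf⇒∈ (suc r) 0 z<s (<-trans (n<1+n _) r+2<s) h>0))
                            (subst (T ∘′ I) (+-identityʳ _) (<heightsOf⇒∈ (2 + r) 0 z<s r+2<s h′>0))
      where
      r+2<s : 2 + r < s
      r+2<s = s≤s r+1<2k

    length-columnsOfIdeal : length (columnsOfIdeal I) ≡ k
    length-columnsOfIdeal = length-columnsOf (heightsOf I) k

    validColumns-columnsOfIdeal : ValidColumns (columnsOfIdeal I)
    validColumns-columnsOfIdeal =
      chain-x-columnsOf (heightsOf I) k 0 (λ 0<k → heightsOf-2 (s≤s (+-mono-≤ 0<k 0<k))) heightsOf-step ,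
      chain-y-columnsOf (heightsOf I) k _ firstY heightsOf-step ,
      separated-columnsOf (heightsOf I) k heightsOf-noAdjacent
      where
      firstY : 0 < k → heightsOf I 1 ≤ suc (suc (lastOr 0 (map proj₁ (columnsOfIdeal I))))
      firstY 0<k@(s≤s {n = k′} _) =
        subst (λ z → heightsOf I 1 ≤ 2 + z) (sym (lastOr-columnsOf (heightsOf I) k′)) (heightsOf-1 0<k)

    idealOf-columnsOfIdeal : ∀ n → idealOf (columnsOfIdeal I) n ≡ I n
    idealOf-columnsOfIdeal = by-residue (λ n → idealOf (columnsOfIdeal I) n ≡ I n) same
      where
      same : ∀ r j → r < s → idealOf (columnsOfIdeal I) (r + j * s) ≡ I (r + j * s)
      same zero j r<s = Bool-ext (λ ∈ → ⊥-elim (∉-residue0 (columnsOfIdeal I) j ∈)) (λ ∈ → ⊥-elim (∉-multiple j ∈))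
      same (suc r) j r<s = Bool-ext
        (λ ∈ → <heightsOf⇒∈ (suc r) j z<s r<s (subst (j <_) height≡ (∈⇒< (columnsOfIdeal I) (suc r) j r<s ∈)))
        (λ ∈ → <⇒∈ (columnsOfIdeal I) (suc r) j r<s (subst (j <_) (sym height≡) (∈⇒<heightsOf (suc r) j z<s r<s ∈)))
        where
        height≡ : heightAt (columnsOfIdeal I) (suc r) ≡ heightsOf I (suc r)
        height≡ = heightAt-columnsOf (heightsOf I) k (suc r) z<s (≤-pred r<s)

  columnsOfIdeal-idealOf : ∀ cs → length cs ≡ k → ValidColumns cs → columnsOfIdeal (idealOf cs) ≡ cs
  columnsOfIdeal-idealOf cs len valid = begin
    columnsOf (heightsOf (idealOf cs)) k       ≡⟨ columnsOf-cong _ _ k same-heights ⟩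
    columnsOf (heightAt cs) k                  ≡⟨ cong (columnsOf (heightAt cs)) (sym len) ⟩
    columnsOf (heightAt cs) (length cs)        ≡⟨ columnsOf-heightAt cs ⟩
    cs                                         ∎
    where
    open ≡-Reasoning
    I = idealOf cs
    ideal = idealOf-isOrderIdeal cs len valid
    noCons = idealOf-noConsecutive cs len valid
    same-heights : ∀ r → 1 ≤ r → r ≤ k + k → heightsOf I r ≡ heightAt cs r
    same-heights r 1≤r r≤2k = ≡-by-<
      (λ j j< → ∈⇒< cs r j (s≤s r≤2k) (<heightsOf⇒∈ I ideal noCons r j 1≤r (s≤s r≤2k) j<))
      (λ j j< → ∈⇒<heightsOf I ideal noCons r j 1≤r (s≤s r≤2k) (<⇒∈ cs r j (s≤s r≤2k) j<))

  ColumnsOfLength : Set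
  ColumnsOfLength = Σ (List Column) (λ cs → length cs ≡ k × ValidColumns cs)

  columnSetoid : Setoid 0ℓ 0ℓ
  columnSetoid = On.setoid (setoid (List Column)) (proj₁ {B = λ cs → length cs ≡ k × ValidColumns cs})

  ideals↔columns : Inverse (IdealSetoid s) columnSetoid
  ideals↔columns = strictInverse toColumns fromColumns
    (λ {I} {J} I≗J → columnsOf-cong _ _ k (λ r _ _ → countBelow-cong (λ j → I≗J (r + j * s)) s))
    (λ { refl n → refl })
    (λ (cs , len , valid) → columnsOfIdeal-idealOf cs len valid)
    (λ (I , ideal , noCons) → idealOf-columnsOfIdeal I ideal noCons)
    where
    toColumns : Setoid.Carrier (IdealSetoid s) → ColumnsOfLength
    toColumns (I , ideal , noCons) =
      columnsOfIdeal I , length-columnsOfIdeal I ideal noCons , validColumns-columnsOfIdeal I ideal noCons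
    fromColumns : ColumnsOfLength → Setoid.Carrier (IdealSetoid s)
    fromColumns (cs , len , valid) = idealOf cs , idealOf-isOrderIdeal cs len valid , idealOf-noConsecutive cs len valid

  columns↔paths : Inverse columnSetoid (listPathSetoid s)
  columns↔paths = strictInverse toPath fromPath (cong pathOfColumns) (cong columnsOfPath)
    (λ (q , len , positive) → pathOfColumns-columnsOfPath q k len (ℤ.<⇒≤ positive))
    (λ (cs , len , valid) → columnsOfPath-pathOfColumns valid)
    where
    toPath : ColumnsOfLength → ListPath s
    toPath (cs , len , valid) =
      pathOfColumns cs , trans (length-pathOfColumns valid) (cong (λ n → suc (n + n)) len) ,
      subst (0ℤ ℤ.<_) (sym (proj₂ (endLevel-pathOfColumns valid))) (ℤ.+<+ z<s)
    fromPath : ListPath s → ColumnsOfLength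
    fromPath (q , len , positive) =
      columnsOfPath q , length-columnsOfPath q k len (ℤ.<⇒≤ positive) , validColumns-columnsOfPath q k len (ℤ.<⇒≤ positive)

theorem1p4 : (s : ℕ) → Odd s → Bijection (IdealSetoid s) (PathSetoid s)
theorem1p4 .(suc (2 * k)) (k , refl) =
  subst (λ n → Bijection (IdealSetoid (suc n)) (PathSetoid (suc n))) (cong (k +_) (sym (+-identityʳ k)))
    (Inverse⇒Bijection (inverse (Gaps.ideals↔columns k) (inverse (Gaps.columns↔paths k) (lists↔vectors _))))
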